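{- For every $g\geq 1$, the number of elements of $E(g)$ of period $2g$ is $$|E'(g)|=\frac{P(2g)}{2g}=\frac{1}{2g}\sum_{\substack{x\mid g\\ x\ \mathrm{odd}}}\mu(x)\,2^{g/x}.$$
   Context: $B(g)$ is the set of binary strings $b=(b_1,\dots,b_{2g})$ of length $2g$ with $b_i\neq b_{i+g}$ for $1\le i\le g$; the cyclic group of order $2g$ acts on $B(g)$ by cyclic shifts and $E(g)$ is the set of orbits. The period of a string is the least positive $k$ such that it is fixed by the shift by $k$ (constant on orbits). $P(k)$ is the number of elements of $B(g)$ of period $k$. $E'(g)\subseteq E(g)$ is the set of orbits of period $2g$ (these correspond to equivalence classes of primitive CM types on a cyclic CM field of degree $2g$). $\mu$ is the Möbius function. -}

module Defs where

open import Data.Bool using (Bool; true; false)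
import Data.Bool.Properties as BoolP
open import Data.Nat using (ℕ; zero; suc; _+_; _*_; _^_; _<_; _≤_; _<?_; _%_; _/_)
open import Data.Nat.DivMod using (m%n<n)
open import Data.Nat.Divisibility using (_∣_; _∣?_)
open import Data.Nat.Primality using (Prime; prime?)
open import Data.Fin using (Fin; toℕ; fromℕ<; _↑ˡ_; _↑ʳ_)
import Data.Fin.Properties as FinP
open import Data.Vec using (Vec; []; _∷_; lookup; tabulate)
import Data.Vec.Properties as VecP
open import Data.List using (List; []; _∷_; [_]; concatMap; filter; length; map; upTo; sum)
open import Data.List.Membership.Propositional using (_∈_)
open import Data.List.Relation.Unary.All using (All)
open import Data.List.Relation.Unary.AllPairs using (AllPairs)
open import Data.List.Relation.Unary.Any using (Any)
open import Data.Integer using (ℤ; +_; -_; 0ℤ; 1ℤ)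
import Data.Integer as ℤ
import Data.List
open import Data.Product using (Σ; ∃; _×_; _,_)
open import Relation.Binary.PropositionalEquality using (_≡_; _≢_)
open import Relation.Nullary using (Dec; yes; no; ¬_)
open import Relation.Nullary.Decidable using (_×-dec_; ¬?)

shift : (n : ℕ) → ℕ → Vec Bool n → Vec Bool n
shift zero    k b = b
shift (suc m) k b = tabulate (λ i → lookup b (fromℕ< (m%n<n (toℕ i + k) (suc m))))

-- b lies in B(g): a string of length 2g = g + g with b_i ≠ b_{i+g} (1 ≤ i ≤ g).
InB : (g : ℕ) → Vec Bool (g + g) → Set
InB g b = ∀ (i : Fin g) → lookup b (i ↑ˡ g) ≢ lookup b (g ↑ʳ i)

InB? : (g : ℕ) → (b : Vec Bool (g + g)) → Dec (InB g b)
InB? g b = FinP.all? (λ i → ¬? (lookup b (i ↑ˡ g) BoolP.≟ lookup b (g ↑ʳ i)))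

HasPeriod : (n : ℕ) → Vec Bool n → ℕ → Set
HasPeriod n b k =
  (0 < k) × (shift n k b ≡ b) × (∀ (j : Fin k) → 0 < toℕ j → shift n (toℕ j) b ≢ b)

HasPeriod? : (n : ℕ) → (b : Vec Bool n) → (k : ℕ) → Dec (HasPeriod n b k)
HasPeriod? n b k =
  (0 <? k) ×-dec (VecP.≡-dec BoolP._≟_ (shift n k b) b)
    ×-dec FinP.all? (λ j → (0 <? toℕ j) Relation.Nullary.Decidable.→-dec
                            ¬? (VecP.≡-dec BoolP._≟_ (shift n (toℕ j) b) b))

allStrings : (n : ℕ) → List (Vec Bool n)
allStrings zero    = [ [] ]
allStrings (suc n) = concatMap (λ v → (true ∷ v) ∷ (false ∷ v) ∷ []) (allStrings n)

P : (g k : ℕ) → ℕ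
P g k = length (filter (λ b → InB? g b ×-dec HasPeriod? (g + g) b k) (allStrings (g + g)))

SameOrbit : (n : ℕ) → Vec Bool n → Vec Bool n → Set
SameOrbit n b c = ∃ λ k → shift n k b ≡ c

-- Elements of B(g) of period 2g (the strings whose orbits form E'(g)).
InB' : (g : ℕ) → Vec Bool (g + g) → Set
InB' g b = InB g b × HasPeriod (g + g) b (g + g)

-- reps is a complete system of representatives of E'(g): one element of
-- each orbit of period 2g, i.e. a list in bijection with E'(g).
IsTransversalE' : (g : ℕ) → List (Vec Bool (g + g)) → Set
IsTransversalE' g reps =
  All (InB' g) reps
  × AllPairs (λ b c → ¬ SameOrbit (g + g) b c) reps
  × (∀ b → InB' g b → Any (λ r → SameOrbit (g + g) b r) reps)

ω : ℕ → ℕ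
ω n = length (filter (λ p → prime? p ×-dec (p ∣? n)) (upTo (suc n)))

SquareFree : ℕ → Set
SquareFree n = ∀ (d : Fin (suc n)) → 1 < toℕ d → ¬ (toℕ d * toℕ d ∣ n)

SquareFree? : (n : ℕ) → Dec (SquareFree n)
SquareFree? n = FinP.all? (λ d → (1 <? toℕ d) Relation.Nullary.Decidable.→-dec ¬? ((toℕ d * toℕ d) ∣? n))

-- μ(0) is set to 0 (never used); μ(n) = (-1)^ω(n) if n squarefree, else 0.
μ : ℕ → ℤ
μ zero = 0ℤ
μ n@(suc _) with SquareFree? n
... | no  _ = 0ℤ
... | yes _ = (- 1ℤ) ℤ.^ ω n

-- Σ_{x ∣ g, x odd} μ(x) 2^{g/x}   (x ranges over 1..g, written x = suc y)
oddDivisorSum : ℕ → ℤ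
oddDivisorSum g = Data.List.foldr ℤ._+_ 0ℤ (map term (upTo g))
  where
  term : ℕ → ℤ
  term y with (suc y ∣? g) ×-dec (suc y % 2 Data.Nat.≟ 1)
  ... | yes _ = μ (suc y) ℤ.* (+ (2 ^ (g / suc y)))
  ... | no  _ = 0ℤ

{-# OPTIONS --safe #-}

-- Every b ∈ B(g) satisfies b(i + g) = ¬ b(i), so its period is 2e with g = e c and c odd, and b is
-- fixed by the shift 2g/x, for an odd divisor x of g, exactly when x ∣ c.  The strings of B(g) fixed
-- by 2d, where g = d x with x odd, are the d-antiperiodic strings; these are determined by their first
-- d entries, so there are 2^d of them.  Hence
--   Σ_{x ∣ g odd} μ(x) 2^{g/x} = Σ_{b ∈ B(g)} Σ_{x ∣ c(b)} μ(x) = #{b ∈ B(g) : c(b) = 1} = P(2g).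
-- An orbit of period 2g has exactly 2g elements, so a transversal of these orbits has P(2g)/2g elements.

module Submission where

open import Defs
open import Level using (Level; 0ℓ)
open import Function using (_∘_; case_of_)
open import Data.Empty using (⊥; ⊥-elim)
open import Data.Sum using (_⊎_; inj₁; inj₂; [_,_]′)
open import Data.Product using (Σ; ∃; ∃₂; _×_; _,_; proj₁; proj₂)
open import Data.Bool using (Bool; true; false; not; _xor_)
import Data.Bool.Properties as Boolₚ
open import Data.Nat as ℕ
  using (ℕ; zero; suc; _+_; _*_; _∸_; _^_; _%_; _/_; _≤_; _<_; _<?_; z≤n; s≤s; NonZero)
import Data.Nat.Properties as ℕₚ
open import Data.Nat.DivMod
open import Data.Nat.Divisibility
open import Data.Nat.Primality as Primality using (Prime; prime?; euclidsLemma; prime⇒irreducible; prime[2])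
open import Data.Nat.Primality.Factorisation using (factorise)
open import Data.Nat.Coprimality using (Coprime; coprime-divisor)
open import Data.Nat.ListAction using (product)
open import Data.Nat.Solver using (module +-*-Solver)
open import Data.Integer as ℤ using (ℤ; +_; -_; 0ℤ; 1ℤ) renaming (_+_ to _+ℤ_; _*_ to _*ℤ_)
import Data.Integer.Properties as ℤₚ
open import Algebra.Properties.CommutativeSemigroup ℤₚ.+-commutativeSemigroup using () renaming (interchange to +ℤ-interchange)
open import Data.Fin using (Fin; toℕ; fromℕ<; _↑ˡ_; _↑ʳ_)
import Data.Fin.Properties as Finₚ
open import Data.Vec using (Vec; []; _∷_; lookup; tabulate)
import Data.Vec.Properties as Vecₚ
open import Data.List using (List; []; _∷_; _++_; map; foldr; filter; length; upTo; applyUpTo; concatMap; deduplicate)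
import Data.List.Properties as Listₚ
open import Data.List.Relation.Unary.All using (All; []; _∷_)
import Data.List.Relation.Unary.All.Properties as Allₚ
open import Data.List.Relation.Unary.Any as Any using (Any; here; there)
import Data.List.Relation.Unary.Any.Properties as Anyₚ
open import Data.List.Relation.Unary.AllPairs as AllPairs using (AllPairs; []; _∷_)
import Data.List.Relation.Unary.Unique.DecSetoid.Properties as Uniqueₚ
open import Data.List.Membership.Propositional using (_∈_)
open import Data.List.Membership.Propositional.Properties using (∈-filter⁺)
open import Relation.Binary.PropositionalEquality
open import Relation.Nullary using (Dec; yes; no; ¬_)
open import Relation.Nullary.Decidable using (map′; _×-dec_; ¬?)
open import Relation.Unary using (Decidable)
open import Relation.Binary.Bundles using (DecSetoid)
open import Relation.Binary.Definitions using (tri<; tri≈; tri>)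

open +-*-Solver using (solve; _:+_; _:*_; _:=_; con)

private
  variable
    a p : Level
    A B : Set a

-- Integer sums and indicators

∑ : List A → (A → ℤ) → ℤ
∑ xs f = foldr _+ℤ_ 0ℤ (map f xs)

∑< : ℕ → (ℕ → ℤ) → ℤ
∑< zero    f = 0ℤ
∑< (suc n) f = f 0 +ℤ ∑< n (f ∘ suc)

when : {P : Set p} → Dec P → ℤ → ℤ
when (yes _) z = z
when (no _)  _ = 0ℤ

𝟙 : {P : Set p} → Dec P → ℤ
𝟙 d = when d 1ℤ

module _ {P : Set a} {Q : Set p} where

  when-cong : (P → Q) → (Q → P) → (x : Dec P) (y : Dec Q) (z : ℤ) → when x z ≡ when y z
  when-cong f g (yes _)  (yes _)  z = refl
  when-cong f g (yes x)  (no ¬y)  z = ⊥-elim (¬y (f x))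
  when-cong f g (no ¬x)  (yes y)  z = ⊥-elim (¬x (g y))
  when-cong f g (no _)   (no _)   z = refl

  𝟙-cong : (P → Q) → (Q → P) → (x : Dec P) (y : Dec Q) → 𝟙 x ≡ 𝟙 y
  𝟙-cong f g x y = when-cong f g x y 1ℤ

module _ {P : Set p} where

  when-yes : P → (x : Dec P) (z : ℤ) → when x z ≡ z
  when-yes _  (yes _)  z = refl
  when-yes px (no ¬px) z = ⊥-elim (¬px px)

  when-no : ¬ P → (x : Dec P) (z : ℤ) → when x z ≡ 0ℤ
  when-no ¬px (yes px) z = ⊥-elim (¬px px)
  when-no _   (no _)   z = refl

  𝟙-yes : P → (x : Dec P) → 𝟙 x ≡ 1ℤ
  𝟙-yes px x = when-yes px x 1ℤ

  𝟙-no : ¬ P → (x : Dec P) → 𝟙 x ≡ 0ℤ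
  𝟙-no ¬px x = when-no ¬px x 1ℤ

  when-0 : (x : Dec P) → when x 0ℤ ≡ 0ℤ
  when-0 (yes _) = refl
  when-0 (no _)  = refl

  when-+-when-neg : (x : Dec P) (z : ℤ) → when x z +ℤ when x (- z) ≡ 0ℤ
  when-+-when-neg (yes _) z = ℤₚ.+-inverseʳ z
  when-+-when-neg (no _)  z = refl

  *-𝟙 : (z : ℤ) (x : Dec P) → z *ℤ 𝟙 x ≡ when x z
  *-𝟙 z (yes _) = ℤₚ.*-identityʳ z
  *-𝟙 z (no _)  = ℤₚ.*-zeroʳ z

∑-cong : (xs : List A) {f g : A → ℤ} → (∀ x → f x ≡ g x) → ∑ xs f ≡ ∑ xs g
∑-cong []       eq = refl
∑-cong (x ∷ xs) eq = cong₂ _+ℤ_ (eq x) (∑-cong xs eq)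

∑-cong-All : {P : A → Set p} (xs : List A) {f g : A → ℤ} →
             All P xs → (∀ x → P x → f x ≡ g x) → ∑ xs f ≡ ∑ xs g
∑-cong-All []       []         eq = refl
∑-cong-All (x ∷ xs) (px ∷ pxs) eq = cong₂ _+ℤ_ (eq x px) (∑-cong-All xs pxs eq)

∑-zero : (xs : List A) → ∑ xs (λ _ → 0ℤ) ≡ 0ℤ
∑-zero []       = refl
∑-zero (x ∷ xs) = trans (ℤₚ.+-identityˡ _) (∑-zero xs)

∑-map : (h : A → B) (xs : List A) (f : B → ℤ) → ∑ (map h xs) f ≡ ∑ xs (f ∘ h)
∑-map h []       f = refl
∑-map h (x ∷ xs) f = cong (f (h x) +ℤ_) (∑-map h xs f)

∑-++ : (xs ys : List A) (f : A → ℤ) → ∑ (xs ++ ys) f ≡ ∑ xs f +ℤ ∑ ys f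
∑-++ []       ys f = sym (ℤₚ.+-identityˡ _)
∑-++ (x ∷ xs) ys f = trans (cong (f x +ℤ_) (∑-++ xs ys f)) (sym (ℤₚ.+-assoc (f x) _ _))

∑-concatMap : (h : A → List B) (xs : List A) (f : B → ℤ) →
              ∑ (concatMap h xs) f ≡ ∑ xs (λ x → ∑ (h x) f)
∑-concatMap h []       f = refl
∑-concatMap h (x ∷ xs) f = trans (∑-++ (h x) (concatMap h xs) f) (cong (∑ (h x) f +ℤ_) (∑-concatMap h xs f))

∑-distrib-+ : (xs : List A) (f g : A → ℤ) → ∑ xs (λ x → f x +ℤ g x) ≡ ∑ xs f +ℤ ∑ xs g
∑-distrib-+ []       f g = refl
∑-distrib-+ (x ∷ xs) f g =
  trans (cong ((f x +ℤ g x) +ℤ_) (∑-distrib-+ xs f g)) (+ℤ-interchange (f x) (g x) (∑ xs f) (∑ xs g))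

∑-*ˡ : (xs : List A) (c : ℤ) (f : A → ℤ) → ∑ xs (λ x → c *ℤ f x) ≡ c *ℤ ∑ xs f
∑-*ˡ []       c f = sym (ℤₚ.*-zeroʳ c)
∑-*ˡ (x ∷ xs) c f = trans (cong (c *ℤ f x +ℤ_) (∑-*ˡ xs c f)) (sym (ℤₚ.*-distribˡ-+ c (f x) _))

∑-comm : (xs : List A) (ys : List B) (h : A → B → ℤ) →
         ∑ xs (λ x → ∑ ys (h x)) ≡ ∑ ys (λ y → ∑ xs (λ x → h x y))
∑-comm []       ys h = sym (∑-zero ys)
∑-comm (x ∷ xs) ys h =
  trans (cong (∑ ys (h x) +ℤ_) (∑-comm xs ys h)) (sym (∑-distrib-+ ys (h x) (λ y → ∑ xs (λ x′ → h x′ y))))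

length-filter-∑ : {P : A → Set p} (P? : Decidable P) (xs : List A) →
                  + length (filter P? xs) ≡ ∑ xs (𝟙 ∘ P?)
length-filter-∑ P? []       = refl
length-filter-∑ P? (x ∷ xs) with P? x
... | yes _ = trans (ℤₚ.pos-+ 1 _) (cong (1ℤ +ℤ_) (length-filter-∑ P? xs))
... | no  _ = trans (length-filter-∑ P? xs) (sym (ℤₚ.+-identityˡ _))

∑-𝟙-unique : {P : A → Set p} (P? : Decidable P) (xs : List A) →
             AllPairs (λ x y → ¬ (P x × P y)) xs → Any P xs → ∑ xs (𝟙 ∘ P?) ≡ 1ℤ
∑-𝟙-unique {P = P} P? (x ∷ xs) (x≁ ∷ _) (here px) =
  cong₂ _+ℤ_ (𝟙-yes px (P? x)) (none xs x≁)
  where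
  none : ∀ ys → All (λ y → ¬ (P x × P y)) ys → ∑ ys (𝟙 ∘ P?) ≡ 0ℤ
  none []       []         = refl
  none (y ∷ ys) (¬xy ∷ ¬s) = cong₂ _+ℤ_ (𝟙-no (λ py → ¬xy (px , py)) (P? y)) (none ys ¬s)
∑-𝟙-unique {P = P} P? (x ∷ xs) (x≁ ∷ ≁) (there any) =
  trans (cong₂ _+ℤ_ (𝟙-no (λ px → clash px x≁ any) (P? x)) (∑-𝟙-unique P? xs ≁ any)) (ℤₚ.+-identityˡ _)
  where
  clash : ∀ {ys} → P x → All (λ y → ¬ (P x × P y)) ys → Any P ys → ⊥
  clash px (¬xy ∷ _) (here py)  = ¬xy (px , py)
  clash px (_ ∷ ¬s)  (there ay) = clash px ¬s ay

∑-upTo : ∀ n (f : ℕ → ℤ) → ∑ (upTo n) f ≡ ∑< n f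
∑-upTo n f = go n (λ i → i)
  where
  go : ∀ n (h : ℕ → ℕ) → ∑ (applyUpTo h n) f ≡ ∑< n (f ∘ h)
  go zero    h = refl
  go (suc n) h = cong (f (h 0) +ℤ_) (go n (h ∘ suc))

∑<-cong : ∀ n {f g : ℕ → ℤ} → (∀ i → i < n → f i ≡ g i) → ∑< n f ≡ ∑< n g
∑<-cong zero    eq = refl
∑<-cong (suc n) eq = cong₂ _+ℤ_ (eq 0 (s≤s z≤n)) (∑<-cong n (λ i i<n → eq (suc i) (s≤s i<n)))

∑<-zero : ∀ n {f : ℕ → ℤ} → (∀ i → i < n → f i ≡ 0ℤ) → ∑< n f ≡ 0ℤ
∑<-zero n eq = trans (∑<-cong n eq) (go n)
  where
  go : ∀ n → ∑< n (λ _ → 0ℤ) ≡ 0ℤ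
  go zero    = refl
  go (suc n) = trans (ℤₚ.+-identityˡ _) (go n)

∑<-+ : ∀ m n (f : ℕ → ℤ) → ∑< (m + n) f ≡ ∑< m f +ℤ ∑< n (λ i → f (m + i))
∑<-+ zero    n f = sym (ℤₚ.+-identityˡ _)
∑<-+ (suc m) n f = trans (cong (f 0 +ℤ_) (∑<-+ m n (f ∘ suc))) (sym (ℤₚ.+-assoc (f 0) _ _))

∑<-suc : ∀ n (f : ℕ → ℤ) → ∑< (suc n) f ≡ ∑< n f +ℤ f n
∑<-suc n f = begin
  ∑< (suc n) f                 ≡⟨ cong (λ k → ∑< k f) (ℕₚ.+-comm 1 n) ⟩
  ∑< (n + 1) f                 ≡⟨ ∑<-+ n 1 f ⟩
  ∑< n f +ℤ (f (n + 0) +ℤ 0ℤ)  ≡⟨ cong (∑< n f +ℤ_) (trans (ℤₚ.+-identityʳ _) (cong f (ℕₚ.+-identityʳ n))) ⟩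
  ∑< n f +ℤ f n                ∎
  where open ≡-Reasoning

∑<-truncate : ∀ m n {f : ℕ → ℤ} → m ≤ n → (∀ i → m ≤ i → i < n → f i ≡ 0ℤ) → ∑< n f ≡ ∑< m f
∑<-truncate m n {f} m≤n vanish = begin
  ∑< n f                                        ≡⟨ cong (λ k → ∑< k f) (sym (ℕₚ.m+[n∸m]≡n m≤n)) ⟩
  ∑< (m + (n ∸ m)) f                            ≡⟨ ∑<-+ m (n ∸ m) f ⟩
  ∑< m f +ℤ ∑< (n ∸ m) (λ i → f (m + i))        ≡⟨ cong (∑< m f +ℤ_) (∑<-zero (n ∸ m) tail-vanishes) ⟩
  ∑< m f +ℤ 0ℤ                                  ≡⟨ ℤₚ.+-identityʳ _ ⟩
  ∑< m f                                        ∎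
  where
  open ≡-Reasoning
  tail-vanishes : ∀ i → i < n ∸ m → f (m + i) ≡ 0ℤ
  tail-vanishes i i<n∸m = vanish (m + i) (ℕₚ.m≤m+n m i)
    (subst (m + i <_) (ℕₚ.m+[n∸m]≡n m≤n) (ℕₚ.+-monoʳ-< m i<n∸m))

∑<-distrib-+ : ∀ n (f g : ℕ → ℤ) → ∑< n (λ i → f i +ℤ g i) ≡ ∑< n f +ℤ ∑< n g
∑<-distrib-+ n f g = begin
  ∑< n (λ i → f i +ℤ g i)         ≡⟨ sym (∑-upTo n _) ⟩
  ∑ (upTo n) (λ i → f i +ℤ g i)   ≡⟨ ∑-distrib-+ (upTo n) f g ⟩
  ∑ (upTo n) f +ℤ ∑ (upTo n) g    ≡⟨ cong₂ _+ℤ_ (∑-upTo n f) (∑-upTo n g) ⟩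
  ∑< n f +ℤ ∑< n g                ∎
  where open ≡-Reasoning

∑<-𝟙-≡ : ∀ n k → k < n → ∑< n (λ i → 𝟙 (i ℕ.≟ k)) ≡ 1ℤ
∑<-𝟙-≡ (suc n) zero    _ =
  cong (1ℤ +ℤ_) (∑<-zero n (λ i _ → 𝟙-no (λ ()) (suc i ℕ.≟ 0)))
∑<-𝟙-≡ (suc n) (suc k) (s≤s k<n) = begin
  𝟙 (0 ℕ.≟ suc k) +ℤ ∑< n (λ i → 𝟙 (suc i ℕ.≟ suc k)) ≡⟨ cong₂ _+ℤ_ (𝟙-no (λ ()) (0 ℕ.≟ suc k)) (∑<-cong n λ i _ → 𝟙-suc i) ⟩
  0ℤ +ℤ ∑< n (λ i → 𝟙 (i ℕ.≟ k))                       ≡⟨ ℤₚ.+-identityˡ _ ⟩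
  ∑< n (λ i → 𝟙 (i ℕ.≟ k))                             ≡⟨ ∑<-𝟙-≡ n k k<n ⟩
  1ℤ                                                   ∎
  where
  open ≡-Reasoning
  𝟙-suc : ∀ i → 𝟙 (suc i ℕ.≟ suc k) ≡ 𝟙 (i ℕ.≟ k)
  𝟙-suc i = 𝟙-cong ℕₚ.suc-injective (cong suc) (suc i ℕ.≟ suc k) (i ℕ.≟ k)

-- Cyclic strings, shifts and periods

LeastPositive : (ℕ → Set p) → ℕ → Set p
LeastPositive P k = 0 < k × P k × (∀ j → 0 < j → j < k → ¬ P j)

module _ {P : ℕ → Set p} (P? : Decidable P) where

  private
    scan : ∀ k → (∀ j → 0 < j → j < k → ¬ P j) ⊎ ∃ (LeastPositive P)
    scan zero       = inj₁ λ _ _ ()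
    scan (suc zero) = inj₁ λ { j 0<j (s≤s j≤0) _ → ℕₚ.<⇒≱ 0<j j≤0 }
    scan (suc k@(suc _)) with scan k
    ... | inj₂ least = inj₂ least
    ... | inj₁ none with P? k
    ...   | yes pk = inj₂ (k , s≤s z≤n , pk , none)
    ...   | no ¬pk = inj₁ λ j 0<j j<1+k → case ℕₚ.m≤n⇒m<n∨m≡n (ℕₚ.≤-pred j<1+k) of λ
                        { (inj₁ j<k) → none j 0<j j<k ; (inj₂ refl) → ¬pk }

  leastPositive : ∀ {n} → 0 < n → P n → ∃ (LeastPositive P)
  leastPositive {n} 0<n pn with scan (suc n)
  ... | inj₂ least = least
  ... | inj₁ none  = ⊥-elim (none n 0<n (ℕₚ.n<1+n n) pn)

_≟ᵥ_ : ∀ {n} → (b c : Vec Bool n) → Dec (b ≡ c)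
_≟ᵥ_ = Vecₚ.≡-dec Boolₚ._≟_

module _ {m : ℕ} where
  private
    n : ℕ
    n = suc m

  index : ℕ → Fin n
  index i = fromℕ< (m%n<n i n)

  at : Vec Bool n → ℕ → Bool
  at b i = lookup b (index i)

  toℕ-index : ∀ i → toℕ (index i) ≡ i % n
  toℕ-index i = Finₚ.toℕ-fromℕ< _

  at-cong-% : ∀ (b : Vec Bool n) i j → i % n ≡ j % n → at b i ≡ at b j
  at-cong-% b i j eq = cong (lookup b) (Finₚ.toℕ-injective (trans (toℕ-index i) (trans eq (sym (toℕ-index j)))))

  at-+-* : ∀ (b : Vec Bool n) i k → at b (i + k * n) ≡ at b i
  at-+-* b i k = at-cong-% b (i + k * n) i ([m+kn]%n≡m%n i k n)

  lookup≡at : ∀ (b : Vec Bool n) (j : Fin n) → lookup b j ≡ at b (toℕ j)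
  lookup≡at b j = cong (lookup b) (Finₚ.toℕ-injective (sym (trans (toℕ-index (toℕ j)) (m<n⇒m%n≡m (Finₚ.toℕ<n j)))))

  at-tabulate : ∀ (h : ℕ → Bool) i → at (tabulate (h ∘ toℕ)) i ≡ h (i % n)
  at-tabulate h i = trans (Vecₚ.lookup∘tabulate (h ∘ toℕ) (index i)) (cong h (toℕ-index i))

  at-shift : ∀ k (b : Vec Bool n) i → at (shift n k b) i ≡ at b (i + k)
  at-shift k b i = begin
    at (shift n k b) i         ≡⟨ at-tabulate (λ j → at b (j + k)) i ⟩
    at b (i % n + k)           ≡⟨ at-cong-% b (i % n + k) (i % n % n + k % n) (%-distribˡ-+ (i % n) k n) ⟩
    at b (i % n % n + k % n)   ≡⟨ cong (λ t → at b (t + k % n)) (m%n%n≡m%n i n) ⟩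
    at b (i % n + k % n)       ≡⟨ at-cong-% b (i % n + k % n) (i + k) (sym (%-distribˡ-+ i k n)) ⟩
    at b (i + k)               ∎
    where open ≡-Reasoning

  at-ext : ∀ {b c : Vec Bool n} → (∀ i → at b i ≡ at c i) → b ≡ c
  at-ext {b} {c} eq = begin
    b                   ≡⟨ sym (Vecₚ.tabulate∘lookup b) ⟩
    tabulate (lookup b) ≡⟨ Vecₚ.tabulate-cong (λ j → trans (lookup≡at b j) (trans (eq (toℕ j)) (sym (lookup≡at c j)))) ⟩
    tabulate (lookup c) ≡⟨ Vecₚ.tabulate∘lookup c ⟩
    c                   ∎
    where open ≡-Reasoning

  record Periodic (k : ℕ) (b : Vec Bool n) : Set where
    constructor periodic
    field at-+-period : ∀ i → at b (i + k) ≡ at b i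
  open Periodic public

  shift≡⇒periodic : ∀ {k b} → shift n k b ≡ b → Periodic k b
  shift≡⇒periodic {k} {b} eq = periodic λ i → trans (sym (at-shift k b i)) (cong (λ c → at c i) eq)

  periodic⇒shift≡ : ∀ {k b} → Periodic k b → shift n k b ≡ b
  periodic⇒shift≡ {k} {b} per = at-ext (λ i → trans (at-shift k b i) (at-+-period per i))

  periodic? : ∀ k b → Dec (Periodic k b)
  periodic? k b = map′ shift≡⇒periodic periodic⇒shift≡ (shift n k b ≟ᵥ b)

  periodic-0 : ∀ b → Periodic 0 b
  periodic-0 b = periodic λ i → cong (at b) (ℕₚ.+-identityʳ i)

  periodic-+ : ∀ {j k b} → Periodic j b → Periodic k b → Periodic (j + k) b
  periodic-+ {j} {k} {b} pj pk = periodic λ i →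
    trans (cong (at b) (sym (ℕₚ.+-assoc i j k))) (trans (at-+-period pk (i + j)) (at-+-period pj i))

  periodic-∸ : ∀ {j k b} → Periodic k b → Periodic (j + k) b → Periodic j b
  periodic-∸ {j} {k} {b} pk pjk = periodic λ i →
    trans (sym (at-+-period pk (i + j))) (trans (cong (at b) (ℕₚ.+-assoc i j k)) (at-+-period pjk i))

  periodic-* : ∀ {k b} q → Periodic k b → Periodic (q * k) b
  periodic-* {b = b} zero    pk = periodic-0 b
  periodic-* {b = b} (suc q) pk = periodic-+ pk (periodic-* q pk)

  periodic-∣ : ∀ {j k b} → j ∣ k → Periodic j b → Periodic k b
  periodic-∣ {b = b} (divides q refl) pj = periodic-* q pj

  periodic-length : ∀ b → Periodic n b
  periodic-length b = periodic λ i → trans (cong (λ t → at b (i + t)) (sym (ℕₚ.*-identityˡ n))) (at-+-* b i 1)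

  periodic-% : ∀ {j k b} .{{_ : NonZero j}} → Periodic j b → Periodic k b → Periodic (k % j) b
  periodic-% {j} {k} {b} pj pk =
    periodic-∸ (periodic-* (k / j) pj) (subst (λ t → Periodic t b) (m≡m%n+[m/n]*n k j) pk)

  hasPeriod : ∀ {b k} → LeastPositive (λ j → Periodic j b) k → HasPeriod n b k
  hasPeriod (0<k , pk , minimal) =
    0<k , periodic⇒shift≡ pk , λ j 0<j → minimal (toℕ j) 0<j (Finₚ.toℕ<n j) ∘ shift≡⇒periodic

  hasPeriod⇒periodic : ∀ {b k} → HasPeriod n b k → Periodic k b
  hasPeriod⇒periodic (_ , shift≡ , _) = shift≡⇒periodic shift≡

  hasPeriod⇒minimal : ∀ {b k} → HasPeriod n b k → ∀ j → 0 < j → j < k → ¬ Periodic j b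
  hasPeriod⇒minimal {b} (_ , _ , minimal) j 0<j j<k pj =
    minimal (fromℕ< j<k) (subst (0 <_) (sym toℕ-j) 0<j) (periodic⇒shift≡ (subst (λ t → Periodic t b) (sym toℕ-j) pj))
    where
    toℕ-j : toℕ (fromℕ< j<k) ≡ j
    toℕ-j = Finₚ.toℕ-fromℕ< j<k

  hasPeriod⇒∣ : ∀ {b k j} → HasPeriod n b k → Periodic j b → k ∣ j
  hasPeriod⇒∣ {b} {suc k} {j} hp pj with j % suc k in eq
  ... | zero  = m%n≡0⇒n∣m j (suc k) eq
  ... | suc r = ⊥-elim (hasPeriod⇒minimal hp (j % suc k) (subst (0 <_) (sym eq) (s≤s z≤n)) (m%n<n j (suc k))
                  (periodic-% (hasPeriod⇒periodic hp) pj))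

  hasPeriod-unique : ∀ {b j k} → HasPeriod n b j → HasPeriod n b k → j ≡ k
  hasPeriod-unique hj hk = ∣-antisym (hasPeriod⇒∣ hj (hasPeriod⇒periodic hk)) (hasPeriod⇒∣ hk (hasPeriod⇒periodic hj))

  period : ∀ b → ∃ (HasPeriod n b)
  period b = let k , least = leastPositive (λ j → periodic? j b) (s≤s z≤n) (periodic-length b) in k , hasPeriod least

  shift-+ : ∀ j k (b : Vec Bool n) → shift n k (shift n j b) ≡ shift n (j + k) b
  shift-+ j k b = at-ext λ i → begin
    at (shift n k (shift n j b)) i ≡⟨ at-shift k (shift n j b) i ⟩
    at (shift n j b) (i + k)       ≡⟨ at-shift j b (i + k) ⟩
    at b (i + k + j)               ≡⟨ cong (at b) (solve 3 (λ i j k → (i :+ k) :+ j := i :+ (j :+ k)) refl i j k) ⟩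
    at b (i + (j + k))             ≡⟨ sym (at-shift (j + k) b i) ⟩
    at (shift n (j + k) b) i       ∎
    where open ≡-Reasoning

  shift-% : ∀ k (b : Vec Bool n) → shift n (k % n) b ≡ shift n k b
  shift-% k b = at-ext λ i → begin
    at (shift n (k % n) b) i        ≡⟨ at-shift (k % n) b i ⟩
    at b (i + k % n)                ≡⟨ sym (at-+-* b (i + k % n) (k / n)) ⟩
    at b (i + k % n + k / n * n)    ≡⟨ cong (at b) (ℕₚ.+-assoc i (k % n) _) ⟩
    at b (i + (k % n + k / n * n))  ≡⟨ cong (λ t → at b (i + t)) (sym (m≡m%n+[m/n]*n k n)) ⟩
    at b (i + k)                    ≡⟨ sym (at-shift k b i) ⟩
    at (shift n k b) i              ∎
    where open ≡-Reasoning

  periodic-shift : ∀ {j k b} → Periodic j b → Periodic j (shift n k b)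
  periodic-shift {j} {k} {b} pj = periodic λ i → begin
    at (shift n k b) (i + j) ≡⟨ at-shift k b (i + j) ⟩
    at b (i + j + k)         ≡⟨ cong (at b) (solve 3 (λ i j k → (i :+ j) :+ k := (i :+ k) :+ j) refl i j k) ⟩
    at b (i + k + j)         ≡⟨ at-+-period pj (i + k) ⟩
    at b (i + k)             ≡⟨ sym (at-shift k b i) ⟩
    at (shift n k b) i       ∎
    where open ≡-Reasoning

  sameOrbit-refl : ∀ b → SameOrbit n b b
  sameOrbit-refl b = 0 , periodic⇒shift≡ (periodic-0 b)

  sameOrbit-sym : ∀ {b c} → SameOrbit n b c → SameOrbit n c b
  sameOrbit-sym {b} (k , refl) = k * n ∸ k , (begin
    shift n (k * n ∸ k) (shift n k b) ≡⟨ shift-+ k (k * n ∸ k) b ⟩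
    shift n (k + (k * n ∸ k)) b       ≡⟨ cong (λ t → shift n t b) (ℕₚ.m+[n∸m]≡n (ℕₚ.m≤m*n k n)) ⟩
    shift n (k * n) b                 ≡⟨ periodic⇒shift≡ (periodic-* k (periodic-length b)) ⟩
    b                                 ∎)
    where open ≡-Reasoning

  sameOrbit-trans : ∀ {b c d} → SameOrbit n b c → SameOrbit n c d → SameOrbit n b d
  sameOrbit-trans {b} (j , refl) (k , refl) = j + k , sym (shift-+ j k b)

  sameOrbit? : ∀ b c → Dec (SameOrbit n b c)
  sameOrbit? b c with Finₚ.any? (λ (j : Fin n) → shift n (toℕ j) b ≟ᵥ c)
  ... | yes (j , eq) = yes (toℕ j , eq)
  ... | no ∄j        = no λ (k , eq) →
    ∄j (index k , trans (cong (λ t → shift n t b) (toℕ-index k)) (trans (shift-% k b) eq))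

  orbitDecSetoid : DecSetoid 0ℓ 0ℓ
  orbitDecSetoid = record
    { Carrier = Vec Bool n
    ; _≈_ = SameOrbit n
    ; isDecEquivalence = record
      { isEquivalence = record { refl = λ {b} → sameOrbit-refl b ; sym = λ {b} {c} → sameOrbit-sym {b} {c}
                               ; trans = λ {b} {c} {d} → sameOrbit-trans {b} {c} {d} }
      ; _≟_ = sameOrbit?
      }
    }

  periodic-sameOrbit : ∀ {j b c} → SameOrbit n b c → Periodic j b → Periodic j c
  periodic-sameOrbit (k , refl) = periodic-shift

  fullPeriod-sameOrbit : ∀ {b c} → SameOrbit n b c → HasPeriod n b n → HasPeriod n c n
  fullPeriod-sameOrbit b~c hp = hasPeriod (s≤s z≤n , periodic-length _ , λ j 0<j j<n →
    hasPeriod⇒minimal hp j 0<j j<n ∘ periodic-sameOrbit (sameOrbit-sym b~c))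

  -- A collision makes  shift n j b, hence b, periodic with period  k ∸ j < n.
  shift-collision : ∀ {b j k} → HasPeriod n b n → j < k → k < n → shift n j b ≢ shift n k b
  shift-collision {b} {j} {k} hp j<k k<n eq = hasPeriod⇒minimal hp (k ∸ j) (ℕₚ.m<n⇒0<n∸m j<k)
    (ℕₚ.≤-<-trans (ℕₚ.m∸n≤m k j) k<n)
    (periodic-sameOrbit (sameOrbit-sym (j , refl)) (shift≡⇒periodic (begin
      shift n (k ∸ j) (shift n j b) ≡⟨ shift-+ j (k ∸ j) b ⟩
      shift n (j + (k ∸ j)) b       ≡⟨ cong (λ t → shift n t b) (ℕₚ.m+[n∸m]≡n (ℕₚ.<⇒≤ j<k)) ⟩
      shift n k b                   ≡⟨ sym eq ⟩
      shift n j b                   ∎)))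
    where open ≡-Reasoning

  shift-injective : ∀ {b j k} → HasPeriod n b n → j < n → k < n → shift n j b ≡ shift n k b → j ≡ k
  shift-injective {b} {j} {k} hp j<n k<n eq with ℕₚ.<-cmp j k
  ... | tri< j<k _ _ = ⊥-elim (shift-collision hp j<k k<n eq)
  ... | tri≈ _ j≡k _ = j≡k
  ... | tri> _ _ k<j = ⊥-elim (shift-collision hp k<j j<n (sym eq))

  Antiperiodic : ℕ → Vec Bool n → Set
  Antiperiodic e b = ∀ i → at b (i + e) ≡ not (at b i)

  antiperiodic-shift : ∀ {e b} k → Antiperiodic e b → Antiperiodic e (shift n k b)
  antiperiodic-shift {e} {b} k anti i = begin
    at (shift n k b) (i + e)  ≡⟨ at-shift k b (i + e) ⟩
    at b (i + e + k)          ≡⟨ cong (at b) (solve 3 (λ i e k → (i :+ e) :+ k := (i :+ k) :+ e) refl i e k) ⟩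
    at b (i + k + e)          ≡⟨ anti (i + k) ⟩
    not (at b (i + k))        ≡⟨ cong not (sym (at-shift k b i)) ⟩
    not (at (shift n k b) i)  ∎
    where open ≡-Reasoning

  antiperiodic-twice : ∀ {e b} → Antiperiodic e b → Periodic (e + e) b
  antiperiodic-twice {e} {b} anti = periodic λ i → begin
    at b (i + (e + e))  ≡⟨ cong (at b) (sym (ℕₚ.+-assoc i e e)) ⟩
    at b (i + e + e)    ≡⟨ anti (i + e) ⟩
    not (at b (i + e))  ≡⟨ cong not (anti i) ⟩
    not (not (at b i))  ≡⟨ Boolₚ.not-involutive _ ⟩
    at b i              ∎
    where open ≡-Reasoning

  antiperiodic⇒¬periodic : ∀ {e b} → Antiperiodic e b → ¬ Periodic e b
  antiperiodic⇒¬periodic {e} {b} anti pe = Boolₚ.not-¬ refl (trans (sym (at-+-period pe 0)) (anti 0))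

module _ {g′ : ℕ} where
  private
    g n : ℕ
    g = suc g′
    n = g + g

  InB⇒≢ : ∀ {b} → InB g b → ∀ i → i < g → at b i ≢ at b (g + i)
  InB⇒≢ {b} inB i i<g eq = inB (fromℕ< i<g) (begin
    lookup b (fromℕ< i<g ↑ˡ g) ≡⟨ lookup≡at b _ ⟩
    at b (toℕ (fromℕ< i<g ↑ˡ g)) ≡⟨ cong (at b) (trans (Finₚ.toℕ-↑ˡ _ g) (Finₚ.toℕ-fromℕ< i<g)) ⟩
    at b i                      ≡⟨ eq ⟩
    at b (g + i)                ≡⟨ cong (at b) (sym (trans (Finₚ.toℕ-↑ʳ g _) (cong (λ t → g + t) (Finₚ.toℕ-fromℕ< i<g)))) ⟩
    at b (toℕ (g ↑ʳ fromℕ< i<g)) ≡⟨ sym (lookup≡at b _) ⟩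
    lookup b (g ↑ʳ fromℕ< i<g) ∎)
    where open ≡-Reasoning

  InB⇒antiperiodic : ∀ {b} → InB g b → Antiperiodic g b
  InB⇒antiperiodic {b} inB i = begin
    at b (i + g)        ≡⟨ at-cong-% b (i + g) (i % n + g) (%-distribˡ-+ʳ i g) ⟩
    at b (i % n + g)    ≡⟨ on-one-period (i % n) (m%n<n i n) ⟩
    not (at b (i % n))  ≡⟨ cong not (at-cong-% b (i % n) i (m%n%n≡m%n i n)) ⟩
    not (at b i)        ∎
    where
    open ≡-Reasoning
    %-distribˡ-+ʳ : ∀ i j → (i + j) % n ≡ (i % n + j) % n
    %-distribˡ-+ʳ i j = begin
      (i + j) % n                ≡⟨ %-distribˡ-+ i j n ⟩
      (i % n + j % n) % n        ≡⟨ cong (λ t → (t + j % n) % n) (sym (m%n%n≡m%n i n)) ⟩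
      (i % n % n + j % n) % n    ≡⟨ sym (%-distribˡ-+ (i % n) j n) ⟩
      (i % n + j) % n            ∎
    on-one-period : ∀ r → r < n → at b (r + g) ≡ not (at b r)
    on-one-period r r<n with r <? g
    ... | yes r<g = trans (cong (at b) (ℕₚ.+-comm r g)) (Boolₚ.¬-not (InB⇒≢ {b} inB r r<g ∘ sym))
    ... | no  r≮g = begin
      at b (r + g)        ≡⟨ cong (λ t → at b (t + g)) (sym r≡g+s) ⟩
      at b (g + s + g)    ≡⟨ cong (at b) (solve 2 (λ g s → (g :+ s) :+ g := s :+ con 1 :* (g :+ g)) refl g s) ⟩
      at b (s + 1 * n)    ≡⟨ at-+-* b s 1 ⟩
      at b s              ≡⟨ Boolₚ.¬-not (InB⇒≢ {b} inB s s<g) ⟩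
      not (at b (g + s))  ≡⟨ cong (λ t → not (at b t)) r≡g+s ⟩
      not (at b r)        ∎
      where
      s : ℕ
      s = r ∸ g
      r≡g+s : g + s ≡ r
      r≡g+s = ℕₚ.m+[n∸m]≡n (ℕₚ.≮⇒≥ r≮g)
      s<g : s < g
      s<g = ℕₚ.+-cancelˡ-< g s g (subst (_< n) (sym r≡g+s) r<n)

  antiperiodic⇒InB : ∀ {b} → Antiperiodic g b → InB g b
  antiperiodic⇒InB {b} anti i eq = Boolₚ.not-¬ refl (begin
    at b (toℕ i)        ≡⟨ cong (at b) (sym (Finₚ.toℕ-↑ˡ i g)) ⟩
    at b (toℕ (i ↑ˡ g)) ≡⟨ sym (lookup≡at b _) ⟩
    lookup b (i ↑ˡ g)   ≡⟨ eq ⟩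
    lookup b (g ↑ʳ i)   ≡⟨ lookup≡at b _ ⟩
    at b (toℕ (g ↑ʳ i)) ≡⟨ cong (at b) (trans (Finₚ.toℕ-↑ʳ g i) (ℕₚ.+-comm g (toℕ i))) ⟩
    at b (toℕ i + g)    ≡⟨ anti (toℕ i) ⟩
    not (at b (toℕ i))  ∎)
    where open ≡-Reasoning

  InB-sameOrbit : ∀ {b c} → SameOrbit n b c → InB g b → InB g c
  InB-sameOrbit {b} (k , refl) inB =
    antiperiodic⇒InB {shift n k b} (antiperiodic-shift {b = b} k (InB⇒antiperiodic {b} inB))

-- Counting strings

count : ∀ {n} → Vec Bool n → List (Vec Bool n) → ℤ
count z L = ∑ L (λ w → 𝟙 (z ≟ᵥ w))

∈-allStrings : ∀ {n} (z : Vec Bool n) → z ∈ allStrings n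
∈-allStrings []      = here refl
∈-allStrings (x ∷ z) = Anyₚ.concatMap⁺ _ (Any.map (λ { refl → ∈-pair x }) (∈-allStrings z))
  where
  ∈-pair : ∀ x → x ∷ z ∈ (true ∷ z) ∷ (false ∷ z) ∷ []
  ∈-pair true  = here refl
  ∈-pair false = there (here refl)

length-allStrings : ∀ n → length (allStrings n) ≡ 2 ^ n
length-allStrings zero    = refl
length-allStrings (suc n) = trans (length-doubled (allStrings n)) (cong (2 *_) (length-allStrings n))
  where
  length-doubled : ∀ (xs : List (Vec Bool n)) →
                   length (concatMap (λ v → (true ∷ v) ∷ (false ∷ v) ∷ []) xs) ≡ 2 * length xs
  length-doubled []       = refl
  length-doubled (x ∷ xs) = trans (cong (λ t → 2 + t) (length-doubled xs)) (sym (ℕₚ.*-suc 2 (length xs)))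

count-allStrings : ∀ n (z : Vec Bool n) → count z (allStrings n) ≡ 1ℤ
count-allStrings zero    []      = refl
count-allStrings (suc n) (x ∷ z) = begin
  count (x ∷ z) (allStrings (suc n))                                       ≡⟨ ∑-concatMap _ (allStrings n) _ ⟩
  ∑ (allStrings n) (λ v → count (x ∷ z) ((true ∷ v) ∷ (false ∷ v) ∷ []))  ≡⟨ ∑-cong (allStrings n) (count-pair x) ⟩
  count z (allStrings n)                                                   ≡⟨ count-allStrings n z ⟩
  1ℤ                                                                       ∎
  where
  open ≡-Reasoning
  𝟙-∷ : ∀ y v → 𝟙 ((y ∷ z) ≟ᵥ (y ∷ v)) ≡ 𝟙 (z ≟ᵥ v)
  𝟙-∷ y v = 𝟙-cong Vecₚ.∷-injectiveʳ (cong (y ∷_)) ((y ∷ z) ≟ᵥ (y ∷ v)) (z ≟ᵥ v)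
  count-pair : ∀ x v → count (x ∷ z) ((true ∷ v) ∷ (false ∷ v) ∷ []) ≡ 𝟙 (z ≟ᵥ v)
  count-pair true v = begin
    𝟙 ((true ∷ z) ≟ᵥ (true ∷ v)) +ℤ (𝟙 ((true ∷ z) ≟ᵥ (false ∷ v)) +ℤ 0ℤ)
      ≡⟨ cong₂ (λ s t → s +ℤ (t +ℤ 0ℤ)) (𝟙-∷ true v) (𝟙-no (λ ()) ((true ∷ z) ≟ᵥ (false ∷ v))) ⟩
    𝟙 (z ≟ᵥ v) +ℤ 0ℤ
      ≡⟨ ℤₚ.+-identityʳ _ ⟩
    𝟙 (z ≟ᵥ v) ∎
  count-pair false v = begin
    𝟙 ((false ∷ z) ≟ᵥ (true ∷ v)) +ℤ (𝟙 ((false ∷ z) ≟ᵥ (false ∷ v)) +ℤ 0ℤ)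
      ≡⟨ cong₂ (λ s t → s +ℤ (t +ℤ 0ℤ)) (𝟙-no (λ ()) ((false ∷ z) ≟ᵥ (true ∷ v))) (𝟙-∷ false v) ⟩
    0ℤ +ℤ (𝟙 (z ≟ᵥ v) +ℤ 0ℤ)
      ≡⟨ trans (ℤₚ.+-identityˡ _) (ℤₚ.+-identityʳ _) ⟩
    𝟙 (z ≟ᵥ v) ∎

length≡∑count : ∀ n (L : List (Vec Bool n)) → + length L ≡ ∑ (allStrings n) (λ z → count z L)
length≡∑count n []      = sym (∑-zero (allStrings n))
length≡∑count n (w ∷ L) = begin
  + suc (length L)                                         ≡⟨ ℤₚ.pos-+ 1 (length L) ⟩
  1ℤ +ℤ + length L                                         ≡⟨ cong₂ _+ℤ_ (sym count-w) (length≡∑count n L) ⟩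
  ∑ U (λ z → 𝟙 (z ≟ᵥ w)) +ℤ ∑ U (λ z → count z L)          ≡⟨ sym (∑-distrib-+ U _ _) ⟩
  ∑ U (λ z → count z (w ∷ L))                              ∎
  where
  open ≡-Reasoning
  U : List (Vec Bool n)
  U = allStrings n
  count-w : ∑ U (λ z → 𝟙 (z ≟ᵥ w)) ≡ 1ℤ
  count-w = trans (∑-cong U (λ z → 𝟙-cong sym sym (z ≟ᵥ w) (w ≟ᵥ z))) (count-allStrings n w)

∑-𝟙-image : ∀ {n d} {P : Vec Bool n → Set p} (P? : Decidable P)
            (f : Vec Bool d → Vec Bool n) (r : Vec Bool n → Vec Bool d) →
            (∀ a → P (f a)) → (∀ a → r (f a) ≡ a) → (∀ b → P b → f (r b) ≡ b) →
            ∑ (allStrings n) (𝟙 ∘ P?) ≡ + (2 ^ d)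
∑-𝟙-image {n = n} {d} {P} P? f r P-f r∘f f∘r = begin
  ∑ (allStrings n) (𝟙 ∘ P?)           ≡⟨ ∑-cong (allStrings n) (sym ∘ count-image) ⟩
  ∑ (allStrings n) (λ z → count z L)  ≡⟨ sym (length≡∑count n L) ⟩
  + length L                          ≡⟨ cong +_ (trans (Listₚ.length-map f (allStrings d)) (length-allStrings d)) ⟩
  + (2 ^ d)                           ∎
  where
  open ≡-Reasoning
  L : List (Vec Bool n)
  L = map f (allStrings d)
  count-image : ∀ z → count z L ≡ 𝟙 (P? z)
  count-image z with P? z
  ... | yes pz = trans (∑-map f (allStrings d) _) (trans (∑-cong (allStrings d) λ a →
          𝟙-cong (λ z≡fa → trans (cong r z≡fa) (r∘f a)) (λ rz≡a → trans (sym (f∘r z pz)) (cong f rz≡a))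
                 (z ≟ᵥ f a) (r z ≟ᵥ a))
          (count-allStrings d (r z)))
  ... | no ¬pz = trans (∑-map f (allStrings d) _) (trans (∑-cong (allStrings d) λ a →
          𝟙-no (λ z≡fa → ¬pz (subst P (sym z≡fa) (P-f a))) (z ≟ᵥ f a))
          (∑-zero (allStrings d)))

-- Orbits and transversals

module _ {m : ℕ} where
  private
    n : ℕ
    n = suc m

  orbit : Vec Bool n → List (Vec Bool n)
  orbit r = map (λ k → shift n k r) (upTo n)

  count-orbit : ∀ {r} → HasPeriod n r n → ∀ z → count z (orbit r) ≡ 𝟙 (sameOrbit? r z)
  count-orbit {r} full z = begin
    count z (orbit r)                       ≡⟨ ∑-map (λ k → shift n k r) (upTo n) (λ w → 𝟙 (z ≟ᵥ w)) ⟩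
    ∑ (upTo n) (λ k → 𝟙 (z ≟ᵥ shift n k r)) ≡⟨ ∑-upTo n (λ k → 𝟙 (z ≟ᵥ shift n k r)) ⟩
    ∑< n (λ k → 𝟙 (z ≟ᵥ shift n k r))       ≡⟨ by-cases (sameOrbit? r z) ⟩
    𝟙 (sameOrbit? r z)                      ∎
    where
    open ≡-Reasoning
    by-cases : (r~z : Dec (SameOrbit n r z)) → ∑< n (λ k → 𝟙 (z ≟ᵥ shift n k r)) ≡ 𝟙 r~z
    by-cases (yes (k , refl)) = trans (∑<-cong n λ i i<n →
      𝟙-cong (λ eq → shift-injective full i<n (m%n<n k n) (trans (sym eq) (sym (shift-% k r))))
             (λ i≡k%n → trans (sym (shift-% k r)) (cong (λ t → shift n t r) (sym i≡k%n)))
             (shift n k r ≟ᵥ shift n i r) (i ℕ.≟ k % n))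
      (∑<-𝟙-≡ n (k % n) (m%n<n k n))
    by-cases (no r≁z) = ∑<-zero n λ i _ → 𝟙-no (λ z≡ → r≁z (i , sym z≡)) (z ≟ᵥ shift n i r)

  length-concatMap-orbit : ∀ (reps : List (Vec Bool n)) → length (concatMap orbit reps) ≡ length reps * n
  length-concatMap-orbit []         = refl
  length-concatMap-orbit (r ∷ reps) = trans (Listₚ.length-++ (orbit r))
    (cong₂ _+_ (trans (Listₚ.length-map _ (upTo n)) (Listₚ.length-upTo n)) (length-concatMap-orbit reps))

module _ {g′ : ℕ} where
  private
    g n : ℕ
    g = suc g′
    n = g + g

  InB'? : Decidable (InB' g)
  InB'? b = InB? g b ×-dec HasPeriod? n b n

  InB'-sameOrbit : ∀ {b c} → SameOrbit n b c → InB' g b → InB' g c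
  InB'-sameOrbit {b} b~c (inB , full) = InB-sameOrbit {g′} {b} b~c inB , fullPeriod-sameOrbit b~c full

  ∑-𝟙-sameOrbit : ∀ {reps} → IsTransversalE' g reps → ∀ z → ∑ reps (λ r → 𝟙 (sameOrbit? r z)) ≡ 𝟙 (InB'? z)
  ∑-𝟙-sameOrbit {reps} (allB' , distinct , cover) z with InB'? z
  ... | yes z∈B' = ∑-𝟙-unique (λ r → sameOrbit? r z) reps
        (AllPairs.map (λ {r} {s} r≁s (r~z , s~z) → r≁s (sameOrbit-trans {b = r} r~z (sameOrbit-sym {b = s} s~z))) distinct)
        (Any.map (sameOrbit-sym {b = z}) (cover z z∈B'))
  ... | no  z∉B' = trans (∑-cong-All reps allB' λ r r∈B' →
                     𝟙-no (λ r~z → z∉B' (InB'-sameOrbit {r} r~z r∈B')) (sameOrbit? r z))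
                   (∑-zero reps)

  transversal-size : ∀ reps → IsTransversalE' g reps → length reps * n ≡ P g n
  transversal-size reps transversal@(allB' , _ , _) = ℤₚ.+-injective (begin
    + (length reps * n)                  ≡⟨ cong +_ (sym (length-concatMap-orbit reps)) ⟩
    + length L                           ≡⟨ length≡∑count n L ⟩
    ∑ U (λ z → count z L)                ≡⟨ ∑-cong U count-orbits ⟩
    ∑ U (𝟙 ∘ InB'?)                      ≡⟨ sym (length-filter-∑ InB'? U) ⟩
    + P g n                              ∎)
    where
    open ≡-Reasoning
    U L : List (Vec Bool n)
    U = allStrings n
    L = concatMap orbit reps
    count-orbits : ∀ z → count z L ≡ 𝟙 (InB'? z)
    count-orbits z = begin
      count z L                          ≡⟨ ∑-concatMap orbit reps _ ⟩
      ∑ reps (λ r → count z (orbit r))   ≡⟨ ∑-cong-All reps allB' (λ r (_ , full) → count-orbit full z) ⟩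
      ∑ reps (λ r → 𝟙 (sameOrbit? r z))  ≡⟨ ∑-𝟙-sameOrbit transversal z ⟩
      𝟙 (InB'? z)                        ∎

  transversal : Σ (List (Vec Bool n)) (IsTransversalE' g)
  transversal = deduplicate sameOrbit? B' , allB' , distinct , cover
    where
    B' : List (Vec Bool n)
    B' = filter InB'? (allStrings n)
    allB' : All (InB' g) (deduplicate sameOrbit? B')
    allB' = Allₚ.deduplicate⁺ sameOrbit? (Allₚ.all-filter InB'? (allStrings n))
    distinct : AllPairs (λ b c → ¬ SameOrbit n b c) (deduplicate sameOrbit? B')
    distinct = Uniqueₚ.deduplicate-! orbitDecSetoid B'
    cover : ∀ b → InB' g b → Any (SameOrbit n b) (deduplicate sameOrbit? B')
    cover b b∈B' = Anyₚ.deduplicate⁺ sameOrbit? (λ {c} {d} d~c b~c → sameOrbit-trans {b = b} b~c (sameOrbit-sym {b = d} d~c))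
      (Any.map (λ { refl → sameOrbit-refl b }) (∈-filter⁺ InB'? (∈-allStrings b) b∈B'))

-- The Möbius function

NoSquareDivisor : ℕ → Set
NoSquareDivisor n = ∀ d → 1 < d → ¬ (d * d ∣ n)

SquareFree⇒NoSquareDivisor : ∀ {n} → 1 ≤ n → SquareFree n → NoSquareDivisor n
SquareFree⇒NoSquareDivisor {suc n} _ sf d 1<d dd∣n =
  sf (fromℕ< d<2+n) (subst (1 <_) (sym toℕ-d) 1<d) (subst (λ t → t * t ∣ suc n) (sym toℕ-d) dd∣n)
  where
  d<2+n : d < suc (suc n)
  d<2+n = s≤s (ℕₚ.≤-trans (ℕₚ.m≤m*n d d {{ℕ.>-nonZero (ℕₚ.<-trans (s≤s z≤n) 1<d)}}) (∣⇒≤ dd∣n))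
  toℕ-d : toℕ (fromℕ< d<2+n) ≡ d
  toℕ-d = Finₚ.toℕ-fromℕ< d<2+n

NoSquareDivisor⇒SquareFree : ∀ {n} → NoSquareDivisor n → SquareFree n
NoSquareDivisor⇒SquareFree nsd d 1<d = nsd (toℕ d) 1<d

noSquareDivisor? : ∀ {n} → 1 ≤ n → Dec (NoSquareDivisor n)
noSquareDivisor? 1≤n = map′ (SquareFree⇒NoSquareDivisor 1≤n) NoSquareDivisor⇒SquareFree (SquareFree? _)

μ-noSquareDivisor : ∀ {n} → 1 ≤ n → NoSquareDivisor n → μ n ≡ (- 1ℤ) ℤ.^ ω n
μ-noSquareDivisor {suc n} _ nsd with SquareFree? (suc n)
... | yes _  = refl
... | no ¬sf = ⊥-elim (¬sf (NoSquareDivisor⇒SquareFree nsd))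

μ-squareDivisor : ∀ {n} → 1 ≤ n → ¬ NoSquareDivisor n → μ n ≡ 0ℤ
μ-squareDivisor {suc n} 1≤n ¬nsd with SquareFree? (suc n)
... | yes sf = ⊥-elim (¬nsd (SquareFree⇒NoSquareDivisor 1≤n sf))
... | no  _  = refl

prime>1 : ∀ {p} → Prime p → 1 < p
prime>1 {p} pp = ℕ.nonTrivial⇒n>1 p {{Primality.prime⇒nonTrivial pp}}

∤⇒coprime : ∀ {p d} → Prime p → ¬ p ∣ d → Coprime d p
∤⇒coprime pp p∤d (i∣d , i∣p) with prime⇒irreducible pp i∣p
... | inj₁ i≡1 = i≡1
... | inj₂ refl = ⊥-elim (p∤d i∣d)

noSquareDivisor-*ʳ : ∀ p c → NoSquareDivisor (p * c) → NoSquareDivisor c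
noSquareDivisor-*ʳ p c nsd d 1<d dd∣c = nsd d 1<d (∣n⇒∣m*n p dd∣c)

noSquareDivisor-*-prime : ∀ {p c} → Prime p → ¬ p ∣ c → NoSquareDivisor c → NoSquareDivisor (p * c)
noSquareDivisor-*-prime {p} {c} pp p∤c nsd d 1<d dd∣pc with p ∣? d
... | yes (divides e refl) = p∤c (∣-trans (m∣m*n (e * e)) (*-cancelˡ-∣ p {{Primality.prime⇒nonZero pp}}
        (subst (_∣ p * c) (solve 2 (λ e p → (e :* p) :* (e :* p) := p :* (p :* (e :* e))) refl e p) dd∣pc)))
... | no  p∤d = nsd d 1<d (coprime-divisor (∤⇒coprime pp p∤dd) dd∣pc)
  where
  p∤dd : ¬ p ∣ d * d
  p∤dd p∣dd = [ p∤d , p∤d ]′ (euclidsLemma d d pp p∣dd)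

primeDivisor? : ∀ n q → Dec (Prime q × q ∣ n)
primeDivisor? n q = prime? q ×-dec (q ∣? n)

ω≡∑ : ∀ n → + ω n ≡ ∑< (suc n) (𝟙 ∘ primeDivisor? n)
ω≡∑ n = trans (length-filter-∑ (primeDivisor? n) (upTo (suc n))) (∑-upTo (suc n) (𝟙 ∘ primeDivisor? n))

∑-primeDivisor-truncate : ∀ {n} N → 1 ≤ n → n ≤ N → ∑< (suc N) (𝟙 ∘ primeDivisor? n) ≡ + ω n
∑-primeDivisor-truncate {n} N 1≤n n≤N = trans
  (∑<-truncate (suc n) (suc N) (s≤s n≤N) λ q n<q _ →
    𝟙-no (λ (_ , q∣n) → ℕₚ.<⇒≱ n<q (∣⇒≤ {{ℕ.>-nonZero 1≤n}} q∣n)) (primeDivisor? n q))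
  (sym (ω≡∑ n))

primeDivisor-*-prime : ∀ {p c} → Prime p → ¬ p ∣ c → ∀ q →
                       𝟙 (primeDivisor? (p * c) q) ≡ 𝟙 (primeDivisor? c q) +ℤ 𝟙 (q ℕ.≟ p)
primeDivisor-*-prime {p} {c} pp p∤c q with q ℕ.≟ p
... | yes refl = begin
  𝟙 (primeDivisor? (p * c) p)        ≡⟨ 𝟙-yes (pp , m∣m*n c) (primeDivisor? (p * c) p) ⟩
  1ℤ                                 ≡⟨ sym (cong (_+ℤ 1ℤ) (𝟙-no (p∤c ∘ proj₂) (primeDivisor? c p))) ⟩
  𝟙 (primeDivisor? c p) +ℤ 1ℤ        ∎
  where open ≡-Reasoning
... | no q≢p = trans (𝟙-cong to (λ (pq , q∣c) → pq , ∣n⇒∣m*n p q∣c) (primeDivisor? (p * c) q) (primeDivisor? c q))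
                     (sym (ℤₚ.+-identityʳ _))
  where
  to : Prime q × q ∣ p * c → Prime q × q ∣ c
  to (pq , q∣pc) with euclidsLemma p c pq q∣pc
  ... | inj₂ q∣c = pq , q∣c
  ... | inj₁ q∣p with prime⇒irreducible pp q∣p
  ...   | inj₁ refl = ⊥-elim (Primality.¬prime[1] pq)
  ...   | inj₂ q≡p  = ⊥-elim (q≢p q≡p)

ω-*-prime : ∀ {p c} → Prime p → ¬ p ∣ c → 1 ≤ c → ω (p * c) ≡ suc (ω c)
ω-*-prime {p} {c} pp p∤c 1≤c = ℤₚ.+-injective (begin
  + ω (p * c)                                                    ≡⟨ ω≡∑ (p * c) ⟩
  ∑< (suc (p * c)) (𝟙 ∘ primeDivisor? (p * c))                   ≡⟨ ∑<-cong (suc (p * c)) (λ q _ → primeDivisor-*-prime pp p∤c q) ⟩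
  ∑< (suc (p * c)) (λ q → 𝟙 (primeDivisor? c q) +ℤ 𝟙 (q ℕ.≟ p))  ≡⟨ ∑<-distrib-+ (suc (p * c)) (𝟙 ∘ primeDivisor? c) (λ q → 𝟙 (q ℕ.≟ p)) ⟩
  ∑< (suc (p * c)) (𝟙 ∘ primeDivisor? c) +ℤ ∑< (suc (p * c)) (λ q → 𝟙 (q ℕ.≟ p))
    ≡⟨ cong₂ _+ℤ_ (∑-primeDivisor-truncate (p * c) 1≤c c≤pc) (∑<-𝟙-≡ (suc (p * c)) p (s≤s p≤pc)) ⟩
  + ω c +ℤ 1ℤ                                                    ≡⟨ ℤₚ.+-comm (+ ω c) 1ℤ ⟩
  + suc (ω c)                                                    ∎)
  where
  open ≡-Reasoning
  c≤pc : c ≤ p * c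
  c≤pc = ℕₚ.m≤n*m c p {{Primality.prime⇒nonZero pp}}
  p≤pc : p ≤ p * c
  p≤pc = ℕₚ.m≤m*n p c {{ℕ.>-nonZero 1≤c}}

prime*-positive : ∀ {p c} → Prime p → 1 ≤ c → 1 ≤ p * c
prime*-positive {p} {c} pp 1≤c = ℕₚ.≤-trans 1≤c (ℕₚ.m≤n*m c p {{Primality.prime⇒nonZero pp}})

μ-*-prime-∣ : ∀ {p c} → Prime p → p ∣ c → 1 ≤ c → μ (p * c) ≡ 0ℤ
μ-*-prime-∣ {p} {c} pp (divides q refl) 1≤c = μ-squareDivisor (prime*-positive pp 1≤c) λ nsd →
  nsd p (prime>1 pp) (divides q (solve 2 (λ q p → p :* (q :* p) := q :* (p :* p)) refl q p))

μ-*-prime-∤ : ∀ {p c} → Prime p → ¬ p ∣ c → 1 ≤ c → μ (p * c) ≡ - μ c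
μ-*-prime-∤ {p} {c} pp p∤c 1≤c with noSquareDivisor? 1≤c
... | yes nsd = begin
  μ (p * c)                          ≡⟨ μ-noSquareDivisor (prime*-positive pp 1≤c) (noSquareDivisor-*-prime pp p∤c nsd) ⟩
  (- 1ℤ) ℤ.^ ω (p * c)               ≡⟨ cong ((- 1ℤ) ℤ.^_) (ω-*-prime pp p∤c 1≤c) ⟩
  (- 1ℤ) *ℤ ((- 1ℤ) ℤ.^ ω c)         ≡⟨ ℤₚ.-1*i≡-i _ ⟩
  - ((- 1ℤ) ℤ.^ ω c)                 ≡⟨ cong -_ (sym (μ-noSquareDivisor 1≤c nsd)) ⟩
  - μ c                              ∎
  where open ≡-Reasoning
... | no ¬nsd = trans (μ-squareDivisor (prime*-positive pp 1≤c) (¬nsd ∘ noSquareDivisor-*ʳ p c))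
                      (cong -_ (sym (μ-squareDivisor 1≤c ¬nsd)))

∑<-multiples : ∀ {p} → 1 ≤ p → ∀ K (h : ℕ → ℤ) →
               ∑< (p * K) (λ d → when (p ∣? d) (h d)) ≡ ∑< K (λ e → h (p * e))
∑<-multiples {p} _ zero h = cong (λ t → ∑< t (λ d → when (p ∣? d) (h d))) (ℕₚ.*-zeroʳ p)
∑<-multiples {p@(suc p′)} 1≤p (suc K) h = begin
  ∑< (p * suc K) f                        ≡⟨ cong (λ t → ∑< t f) (ℕₚ.*-suc p K) ⟩
  ∑< (p + p * K) f                        ≡⟨ ∑<-+ p (p * K) f ⟩
  ∑< p f +ℤ ∑< (p * K) (λ i → f (p + i))  ≡⟨ cong₂ _+ℤ_ first-block later-blocks ⟩
  h 0 +ℤ ∑< K (λ e → h (p + p * e))       ≡⟨ cong₂ _+ℤ_ (cong h (sym (ℕₚ.*-zeroʳ p))) (∑<-cong K λ e _ → cong h (sym (ℕₚ.*-suc p e))) ⟩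
  ∑< (suc K) (λ e → h (p * e))            ∎
  where
  open ≡-Reasoning
  f : ℕ → ℤ
  f d = when (p ∣? d) (h d)
  first-block : ∑< p f ≡ h 0
  first-block = trans
    (cong₂ _+ℤ_ (when-yes (p ∣0) (p ∣? 0) (h 0))
                (∑<-zero p′ λ i i<p′ → when-no (λ p∣1+i → ℕₚ.<⇒≱ (s≤s i<p′) (∣⇒≤ p∣1+i)) (p ∣? suc i) (h (suc i))))
    (ℤₚ.+-identityʳ _)
  later-blocks : ∑< (p * K) (λ i → f (p + i)) ≡ ∑< K (λ e → h (p + p * e))
  later-blocks = trans
    (∑<-cong (p * K) λ i _ → when-cong (λ p∣p+i → ∣m+n∣m⇒∣n p∣p+i ∣-refl) (∣m∣n⇒∣m+n ∣-refl) (p ∣? (p + i)) (p ∣? i) (h (p + i)))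
    (∑<-multiples 1≤p K (λ i → h (p + i)))

∑<-when-truncate : ∀ {P : ℕ → Set p} (P? : Decidable P) {m N} → (∀ d → P d → d ≤ m) → m ≤ N → (f : ℕ → ℤ) →
                   ∑< (suc N) (λ d → when (P? d) (f d)) ≡ ∑< (suc m) (λ d → when (P? d) (f d))
∑<-when-truncate P? bound m≤N f = ∑<-truncate _ _ (s≤s m≤N) λ d m<d _ →
  when-no (λ pd → ℕₚ.<⇒≱ m<d (bound d pd)) (P? d) (f d)

∑∣ : ℕ → (ℕ → ℤ) → ℤ
∑∣ m f = ∑< (suc m) (λ d → when (d ∣? m) (f d))

∣⇒positive : ∀ {d m} → 1 ≤ m → d ∣ m → 1 ≤ d
∣⇒positive {zero} 1≤m 0∣m = ⊥-elim (ℕₚ.<⇒≢ 1≤m (sym (0∣⇒≡0 0∣m)))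
∣⇒positive {suc d} _ _ = s≤s z≤n

module _ {p c : ℕ} (pp : Prime p) where

  private
    instance
      p≢0 : NonZero p
      p≢0 = Primality.prime⇒nonZero pp

  coprimeDivisor? : ∀ d → Dec (d ∣ c × ¬ p ∣ d)
  coprimeDivisor? d = (d ∣? c) ×-dec ¬? (p ∣? d)

  when-∣-prime*-split : ∀ d v → when (d ∣? p * c) v ≡ when (coprimeDivisor? d) v +ℤ when (p ∣? d) (when (d ∣? p * c) v)
  when-∣-prime*-split d v with p ∣? d
  ... | yes p∣d = sym (trans (cong (_+ℤ when (d ∣? p * c) v) (when-no (λ (_ , p∤d) → p∤d p∣d) ((d ∣? c) ×-dec ¬? (yes p∣d)) v))
                             (ℤₚ.+-identityˡ _))
  ... | no  p∤d = trans (when-cong (λ d∣pc → coprime-divisor (∤⇒coprime pp p∤d) d∣pc , p∤d) (λ (d∣c , _) → ∣n⇒∣m*n p d∣c)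
                                   (d ∣? p * c) ((d ∣? c) ×-dec ¬? (no p∤d)) v)
                        (sym (ℤₚ.+-identityʳ _))

  when-μ-prime* : 1 ≤ c → ∀ e → when (p * e ∣? p * c) (μ (p * e)) ≡ when (coprimeDivisor? e) (- μ e)
  when-μ-prime* 1≤c e with e ∣? c | p ∣? e
  ... | no e∤c | p?e = trans (when-no (e∤c ∘ *-cancelˡ-∣ p) (p * e ∣? p * c) _)
                             (sym (when-no (e∤c ∘ proj₁) (no e∤c ×-dec ¬? p?e) (- μ e)))
  ... | yes e∣c | yes p∣e = trans (when-yes (*-monoʳ-∣ p e∣c) (p * e ∣? p * c) _)
    (trans (μ-*-prime-∣ pp p∣e (∣⇒positive 1≤c e∣c)) (sym (when-no (λ (_ , p∤e) → p∤e p∣e) (yes e∣c ×-dec ¬? (yes p∣e)) (- μ e))))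
  ... | yes e∣c | no p∤e = trans (when-yes (*-monoʳ-∣ p e∣c) (p * e ∣? p * c) _)
    (trans (μ-*-prime-∤ pp p∤e (∣⇒positive 1≤c e∣c)) (sym (when-yes (e∣c , p∤e) (yes e∣c ×-dec ¬? (no p∤e)) _)))

  -- Divisors of p c not divisible by p are the d ∣ c with p ∤ d; the others are the p e with e ∣ c,
  -- and μ (p e) = - μ e or 0 pairs them off against the first kind.
  ∑∣-μ-prime* : 1 ≤ c → ∑∣ (p * c) μ ≡ 0ℤ
  ∑∣-μ-prime* 1≤c = begin
    ∑∣ (p * c) μ                                                 ≡⟨ ∑<-cong (suc (p * c)) (λ d _ → when-∣-prime*-split d (μ d)) ⟩
    ∑< (suc (p * c)) (λ d → coprimePart d +ℤ multiplePart d)     ≡⟨ ∑<-distrib-+ (suc (p * c)) coprimePart multiplePart ⟩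
    ∑< (suc (p * c)) coprimePart +ℤ ∑< (suc (p * c)) multiplePart
      ≡⟨ cong₂ _+ℤ_ (∑<-when-truncate coprimeDivisor? (λ d (d∣c , _) → ∣⇒≤ {{ℕ.>-nonZero 1≤c}} d∣c) c≤pc μ) multiples ⟩
    ∑< (suc c) coprimePart +ℤ ∑< (suc c) negatedPart             ≡⟨ sym (∑<-distrib-+ (suc c) coprimePart negatedPart) ⟩
    ∑< (suc c) (λ e → coprimePart e +ℤ negatedPart e)            ≡⟨ ∑<-zero (suc c) (λ e _ → when-+-when-neg (coprimeDivisor? e) (μ e)) ⟩
    0ℤ                                                           ∎
    where
    open ≡-Reasoning
    coprimePart multiplePart negatedPart : ℕ → ℤ
    coprimePart  d = when (coprimeDivisor? d) (μ d)
    multiplePart d = when (p ∣? d) (when (d ∣? p * c) (μ d))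
    negatedPart  e = when (coprimeDivisor? e) (- μ e)
    c≤pc : c ≤ p * c
    c≤pc = ℕₚ.m≤n*m c p
    multiples : ∑< (suc (p * c)) multiplePart ≡ ∑< (suc c) negatedPart
    multiples = begin
      ∑< (suc (p * c)) multiplePart
        ≡⟨ ∑<-suc (p * c) multiplePart ⟩
      ∑< (p * c) multiplePart +ℤ multiplePart (p * c)
        ≡⟨ cong₂ _+ℤ_ (∑<-multiples (ℕₚ.<⇒≤ (prime>1 pp)) c (λ d → when (d ∣? p * c) (μ d))) (when-yes (m∣m*n c) (p ∣? p * c) _) ⟩
      ∑< c (λ e → when (p * e ∣? p * c) (μ (p * e))) +ℤ when (p * c ∣? p * c) (μ (p * c))
        ≡⟨ sym (∑<-suc c (λ e → when (p * e ∣? p * c) (μ (p * e)))) ⟩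
      ∑< (suc c) (λ e → when (p * e ∣? p * c) (μ (p * e)))
        ≡⟨ ∑<-cong (suc c) (λ e _ → when-μ-prime* 1≤c e) ⟩
      ∑< (suc c) negatedPart ∎

∑∣-μ : ∀ {m} → 1 ≤ m → ∑∣ m μ ≡ 𝟙 (m ℕ.≟ 1)
∑∣-μ {suc zero}       _ = refl
∑∣-μ {m@(suc (suc k))} _ with factorise m
... | record { factors = [] ; isFactorisation = () }
... | record { factors = p ∷ ps ; isFactorisation = m≡p*ps ; factorsPrime = pp ∷ psPrime } = begin
  ∑∣ m μ                  ≡⟨ cong (λ t → ∑∣ t μ) m≡p*ps ⟩
  ∑∣ (p * product ps) μ   ≡⟨ ∑∣-μ-prime* pp (Primality.productOfPrimes≥1 psPrime) ⟩
  0ℤ                      ≡⟨ sym (𝟙-no (λ ()) (m ℕ.≟ 1)) ⟩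
  𝟙 (m ℕ.≟ 1)             ∎
  where open ≡-Reasoning

∑∣≡∑<-suc : ∀ {m} N (f : ℕ → ℤ) → 1 ≤ m → m ≤ N → ∑∣ m f ≡ ∑< N (λ y → when (suc y ∣? m) (f (suc y)))
∑∣≡∑<-suc {m} N f 1≤m m≤N = begin
  ∑< (suc m) (λ d → when (d ∣? m) (f d))
    ≡⟨ sym (∑<-when-truncate (_∣? m) (λ d d∣m → ∣⇒≤ {{ℕ.>-nonZero 1≤m}} d∣m) m≤N f) ⟩
  when (0 ∣? m) (f 0) +ℤ ∑< N (λ y → when (suc y ∣? m) (f (suc y)))
    ≡⟨ cong (_+ℤ ∑< N (λ y → when (suc y ∣? m) (f (suc y)))) (when-no (λ 0∣m → ℕₚ.<⇒≢ 1≤m (sym (0∣⇒≡0 0∣m))) (0 ∣? m) (f 0)) ⟩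
  0ℤ +ℤ ∑< N (λ y → when (suc y ∣? m) (f (suc y)))
    ≡⟨ ℤₚ.+-identityˡ _ ⟩
  ∑< N (λ y → when (suc y ∣? m) (f (suc y))) ∎
  where open ≡-Reasoning

-- Antiperiodic strings

oddᵇ : ℕ → Bool
oddᵇ zero    = false
oddᵇ (suc k) = not (oddᵇ k)

module _ {m : ℕ} where
  private
    n : ℕ
    n = suc m

  antiperiodic-iterate : ∀ {d} {b : Vec Bool n} → Antiperiodic d b → ∀ k i → at b (i + k * d) ≡ oddᵇ k xor at b i
  antiperiodic-iterate {d} {b} anti zero    i = cong (at b) (ℕₚ.+-identityʳ i)
  antiperiodic-iterate {d} {b} anti (suc k) i = begin
    at b (i + (d + k * d))    ≡⟨ cong (at b) (solve 3 (λ i d k → i :+ (d :+ k) := (i :+ k) :+ d) refl i d (k * d)) ⟩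
    at b (i + k * d + d)      ≡⟨ anti (i + k * d) ⟩
    not (at b (i + k * d))    ≡⟨ cong not (antiperiodic-iterate {d} {b} anti k i) ⟩
    not (oddᵇ k xor at b i)   ≡⟨ Boolₚ.not-distribˡ-xor (oddᵇ k) (at b i) ⟩
    oddᵇ (suc k) xor at b i   ∎
    where open ≡-Reasoning

  -- The antiperiodic extension of a block of length d flips its k-th copy exactly when k is odd.
  module _ {d′ q : ℕ} (n≡q*2d : n ≡ q * (suc d′ + suc d′)) where
    private
      d : ℕ
      d = suc d′

    twist : Vec Bool d → ℕ → Bool
    twist a i = oddᵇ (i / d) xor at a i

    twist-+d : ∀ a i → twist a (i + d) ≡ not (twist a i)
    twist-+d a i = begin
      oddᵇ ((i + d) / d) xor at a (i + d) ≡⟨ cong₂ _xor_ (cong oddᵇ [i+d]/d≡1+i/d) (at-+-period (periodic-length a) i) ⟩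
      oddᵇ (suc (i / d)) xor at a i       ≡⟨ sym (Boolₚ.not-distribˡ-xor (oddᵇ (i / d)) (at a i)) ⟩
      not (twist a i)                     ∎
      where
      open ≡-Reasoning
      [i+d]/d≡1+i/d : (i + d) / d ≡ suc (i / d)
      [i+d]/d≡1+i/d = trans (m/n≡1+[m∸n]/n (ℕₚ.m≤n+m d i)) (cong (λ t → suc (t / d)) (ℕₚ.m+n∸n≡m i d))

    twist-+2d* : ∀ a k i → twist a (i + k * (d + d)) ≡ twist a i
    twist-+2d* a zero    i = cong (twist a) (ℕₚ.+-identityʳ i)
    twist-+2d* a (suc k) i = begin
      twist a (i + (d + d + k * (d + d)))  ≡⟨ cong (twist a) (solve 3 (λ i d k → i :+ ((d :+ d) :+ k) := ((i :+ k) :+ d) :+ d) refl i d (k * (d + d))) ⟩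
      twist a (i + k * (d + d) + d + d)    ≡⟨ twist-+d a (i + k * (d + d) + d) ⟩
      not (twist a (i + k * (d + d) + d))  ≡⟨ cong not (twist-+d a (i + k * (d + d))) ⟩
      not (not (twist a (i + k * (d + d)))) ≡⟨ Boolₚ.not-involutive _ ⟩
      twist a (i + k * (d + d))            ≡⟨ twist-+2d* a k i ⟩
      twist a i                            ∎
      where open ≡-Reasoning

    twist-% : ∀ a i → twist a (i % n) ≡ twist a i
    twist-% a i = begin
      twist a (i % n)                              ≡⟨ sym (twist-+2d* a (i / n * q) (i % n)) ⟩
      twist a (i % n + i / n * q * (d + d))        ≡⟨ cong (λ t → twist a (i % n + t)) (ℕₚ.*-assoc (i / n) q (d + d)) ⟩
      twist a (i % n + i / n * (q * (d + d)))      ≡⟨ cong (λ t → twist a (i % n + i / n * t)) (sym n≡q*2d) ⟩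
      twist a (i % n + i / n * n)                  ≡⟨ cong (twist a) (sym (m≡m%n+[m/n]*n i n)) ⟩
      twist a i                                    ∎
      where open ≡-Reasoning

    extend : Vec Bool d → Vec Bool n
    extend a = tabulate (twist a ∘ toℕ)

    restrict : Vec Bool n → Vec Bool d
    restrict b = tabulate (at b ∘ toℕ)

    at-extend : ∀ a i → at (extend a) i ≡ twist a i
    at-extend a i = trans (at-tabulate (twist a) i) (twist-% a i)

    extend-antiperiodic : ∀ a → Antiperiodic d (extend a)
    extend-antiperiodic a i = trans (at-extend a (i + d)) (trans (twist-+d a i) (cong not (sym (at-extend a i))))

    restrict∘extend : ∀ a → restrict (extend a) ≡ a
    restrict∘extend a = at-ext λ i → begin
      at (restrict (extend a)) i              ≡⟨ at-tabulate (at (extend a)) i ⟩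
      at (extend a) (i % d)                   ≡⟨ at-extend a (i % d) ⟩
      oddᵇ (i % d / d) xor at a (i % d)       ≡⟨ cong (λ k → oddᵇ k xor at a (i % d)) (m<n⇒m/n≡0 (m%n<n i d)) ⟩
      at a (i % d)                            ≡⟨ at-cong-% a (i % d) i (m%n%n≡m%n i d) ⟩
      at a i                                  ∎
      where open ≡-Reasoning

    extend∘restrict : ∀ {b} → Antiperiodic d b → extend (restrict b) ≡ b
    extend∘restrict {b} anti = at-ext λ i → begin
      at (extend (restrict b)) i                     ≡⟨ at-extend (restrict b) i ⟩
      oddᵇ (i / d) xor at (restrict b) i             ≡⟨ cong (oddᵇ (i / d) xor_) (at-tabulate (at b) i) ⟩
      oddᵇ (i / d) xor at b (i % d)                  ≡⟨ sym (antiperiodic-iterate {d} {b} anti (i / d) (i % d)) ⟩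
      at b (i % d + i / d * d)                       ≡⟨ cong (at b) (sym (m≡m%n+[m/n]*n i d)) ⟩
      at b i                                         ∎
      where open ≡-Reasoning

    ∑-𝟙-antiperiodic : ∀ {P : Vec Bool n → Set p} (P? : Decidable P) →
                       (∀ {b} → P b → Antiperiodic d b) → (∀ {b} → Antiperiodic d b → P b) →
                       ∑ (allStrings n) (𝟙 ∘ P?) ≡ + (2 ^ d)
    ∑-𝟙-antiperiodic P? P⇒anti anti⇒P = ∑-𝟙-image P? extend restrict
      (anti⇒P ∘ extend-antiperiodic) restrict∘extend (λ b → extend∘restrict ∘ P⇒anti)

-- Periods and shift-invariant strings in B(g)

+-double-injective : ∀ {m n} → m + m ≡ n + n → m ≡ n
+-double-injective {m} {n} eq = trans (ℕₚ.n≡⌊n+n/2⌋ m) (trans (cong ℕ.⌊_/2⌋ eq) (sym (ℕₚ.n≡⌊n+n/2⌋ n)))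

∣⇒+-double-∣ : ∀ {e k} → e ∣ k → e + e ∣ k + k
∣⇒+-double-∣ {e} (divides q refl) = divides q (sym (ℕₚ.*-distribˡ-+ q e e))

+-double-∣⇒∣ : ∀ {e k} → e + e ∣ k + k → e ∣ k
+-double-∣⇒∣ {e} (divides q eq) = divides q (+-double-injective (trans eq (ℕₚ.*-distribˡ-+ q e e)))

¬2∣⇒odd : ∀ {c} → ¬ 2 ∣ c → c % 2 ≡ 1
¬2∣⇒odd {c} 2∤c with c % 2 in eq | m%n<n c 2
... | 0 | _ = ⊥-elim (2∤c (m%n≡0⇒n∣m c 2 eq))
... | 1 | _ = refl
... | suc (suc _) | s≤s (s≤s ())

odd⇒¬2∣ : ∀ {c} → c % 2 ≡ 1 → ¬ 2 ∣ c
odd⇒¬2∣ {c} odd 2∣c with () ← trans (sym (n∣m⇒m%n≡0 c 2 2∣c)) odd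

∣-odd : ∀ {x m} → x ∣ m → m % 2 ≡ 1 → x % 2 ≡ 1
∣-odd x∣m odd = ¬2∣⇒odd (λ 2∣x → odd⇒¬2∣ odd (∣-trans 2∣x x∣m))

module _ {g′ : ℕ} where
  private
    g n : ℕ
    g = suc g′
    n = g + g

  -- p ∣ 2g, and p ∤ g since b is antiperiodic with antiperiod g; so the cofactor 2g / p is odd.
  period-InB : ∀ {b p} → InB g b → HasPeriod n b p → ∃₂ λ e m → p ≡ e + e × g ≡ e * m × m % 2 ≡ 1
  period-InB {b} {p} inB hp with hasPeriod⇒∣ hp (periodic-length b)
  ... | divides c n≡cp with 2 ∣? c
  ...   | yes (divides c′ refl) = ⊥-elim (antiperiodic⇒¬periodic {e = g} {b} (InB⇒antiperiodic {g′} {b} inB)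
            (periodic-∣ (divides c′ (+-double-injective (trans n≡cp (solve 2 (λ c p → c :* con 2 :* p := c :* p :+ c :* p) refl c′ p))))
              (hasPeriod⇒periodic hp)))
  ...   | no 2∤c with euclidsLemma c p prime[2] (divides g (trans (sym n≡cp) (solve 1 (λ g → g :+ g := g :* con 2) refl g)))
  ...     | inj₁ 2∣c = ⊥-elim (2∤c 2∣c)
  ...     | inj₂ (divides e refl) = e , c , solve 1 (λ e → e :* con 2 := e :+ e) refl e ,
            +-double-injective (trans n≡cp (solve 2 (λ c e → c :* (e :* con 2) := e :* c :+ e :* c) refl c e)) ,
            ¬2∣⇒odd 2∤c

  InB∧periodic⇔antiperiodic : ∀ {d x} → d * x ≡ g → x % 2 ≡ 1 → ∀ {b} →
                               (InB g b × Periodic (d + d) b → Antiperiodic d b) × (Antiperiodic d b → InB g b × Periodic (d + d) b)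
  InB∧periodic⇔antiperiodic {d} {x} dx≡g odd {b} = to , from
    where
    t : ℕ
    t = x / 2
    g≡d+t*2d : g ≡ d + t * (d + d)
    g≡d+t*2d = begin
      g                  ≡⟨ sym dx≡g ⟩
      d * x              ≡⟨ cong (d *_) (trans (m≡m%n+[m/n]*n x 2) (cong (_+ t * 2) odd)) ⟩
      d * (1 + t * 2)    ≡⟨ solve 2 (λ d t → d :* (con 1 :+ t :* con 2) := d :+ t :* (d :+ d)) refl d t ⟩
      d + t * (d + d)    ∎
      where open ≡-Reasoning
    at-+g : ∀ i → at b (i + g) ≡ at b (i + d + t * (d + d))
    at-+g i = cong (at b) (trans (cong (λ k → i + k) g≡d+t*2d) (sym (ℕₚ.+-assoc i d _)))
    to : InB g b × Periodic (d + d) b → Antiperiodic d b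
    to (inB , per) i = begin
      at b (i + d)                    ≡⟨ sym (at-+-period (periodic-* t per) (i + d)) ⟩
      at b (i + d + t * (d + d))      ≡⟨ sym (at-+g i) ⟩
      at b (i + g)                    ≡⟨ InB⇒antiperiodic {g′} {b} inB i ⟩
      not (at b i)                    ∎
      where open ≡-Reasoning
    from : Antiperiodic d b → InB g b × Periodic (d + d) b
    from anti = antiperiodic⇒InB {g′} {b} (λ i → begin
      at b (i + g)                    ≡⟨ at-+g i ⟩
      at b (i + d + t * (d + d))      ≡⟨ at-+-period (periodic-* t per) (i + d) ⟩
      at b (i + d)                    ≡⟨ anti i ⟩
      not (at b i)                    ∎) , per
      where
      open ≡-Reasoning
      per : Periodic (d + d) b
      per = antiperiodic-twice {e = d} {b} anti

  fixedBy? : ∀ d b → Dec (InB g b × Periodic (d + d) b)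
  fixedBy? d b = InB? g b ×-dec periodic? (d + d) b

  ∑-𝟙-fixedBy : ∀ {d x} → d * x ≡ g → x % 2 ≡ 1 → ∑ (allStrings n) (𝟙 ∘ fixedBy? d) ≡ + (2 ^ d)
  ∑-𝟙-fixedBy {zero}   {x} () _
  ∑-𝟙-fixedBy {suc d′} {x} dx≡g odd = ∑-𝟙-antiperiodic {q = x} n≡x*2d (fixedBy? d)
    (λ {b} → proj₁ (InB∧periodic⇔antiperiodic dx≡g odd {b})) (λ {b} → proj₂ (InB∧periodic⇔antiperiodic dx≡g odd {b}))
    where
    d : ℕ
    d = suc d′
    n≡x*2d : n ≡ x * (d + d)
    n≡x*2d = trans (cong (λ t → t + t) (sym dx≡g)) (solve 2 (λ d x → d :* x :+ d :* x := x :* (d :+ d)) refl d x)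

  periodic-cofactor⇔∣ : ∀ {b e c} → HasPeriod n b (e + e) → g ≡ e * c → ∀ {x} .{{_ : NonZero x}} → x ∣ g →
                        (Periodic (g / x + g / x) b → x ∣ c) × (x ∣ c → Periodic (g / x + g / x) b)
  periodic-cofactor⇔∣ {b} {e} {c} hp g≡ec {x} x∣g = to , from
    where
    instance
      e≢0 : NonZero e
      e≢0 = ℕ.>-nonZero (ℕₚ.n≢0⇒n>0 λ { refl → ℕₚ.<-irrefl refl (proj₁ hp) })
    to : Periodic (g / x + g / x) b → x ∣ c
    to per with +-double-∣⇒∣ {k = g / x} (hasPeriod⇒∣ hp per)
    ... | divides q g/x≡qe = divides q (ℕₚ.*-cancelˡ-≡ c (q * x) e (begin
      e * c        ≡⟨ sym g≡ec ⟩
      g            ≡⟨ sym (m/n*n≡m x∣g) ⟩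
      g / x * x    ≡⟨ cong (_* x) g/x≡qe ⟩
      q * e * x    ≡⟨ solve 3 (λ q e x → q :* e :* x := e :* (q :* x)) refl q e x ⟩
      e * (q * x)  ∎))
      where open ≡-Reasoning
    from : x ∣ c → Periodic (g / x + g / x) b
    from (divides q c≡qx) = periodic-∣ (∣⇒+-double-∣ {k = g / x} (divides q (ℕₚ.*-cancelʳ-≡ (g / x) (q * e) x (begin
      g / x * x    ≡⟨ m/n*n≡m x∣g ⟩
      g            ≡⟨ g≡ec ⟩
      e * c        ≡⟨ cong (e *_) c≡qx ⟩
      e * (q * x)  ≡⟨ solve 3 (λ q e x → e :* (q :* x) := q :* e :* x) refl q e x ⟩
      q * e * x    ∎)))) (hasPeriod⇒periodic hp)
      where open ≡-Reasoning

-- The odd divisor sum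

oddDivisor? : ∀ g y → Dec (suc y ∣ g × suc y % 2 ≡ 1)
oddDivisor? g y = (suc y ∣? g) ×-dec (suc y % 2 ℕ.≟ 1)

oddDivisorTerm : ℕ → ℕ → ℤ
oddDivisorTerm g y = when (oddDivisor? g y) (μ (suc y) *ℤ + (2 ^ (g / suc y)))

-- The summand of oddDivisorSum is local to its where block; unification against refl names it.
summandOf : {f : ℕ → ℤ} (xs : List ℕ) → ∑ xs f ≡ ∑ xs f → ℕ → ℤ
summandOf {f} _ _ = f

summandOf-oddDivisorSum : ∀ g y → summandOf (upTo g) (refl {x = oddDivisorSum g}) y ≡ oddDivisorTerm g y
summandOf-oddDivisorSum g y with (suc y ∣? g) ×-dec (suc y % 2 ℕ.≟ 1)
... | yes _ = refl
... | no  _ = refl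

oddDivisorSum≡∑< : ∀ g → oddDivisorSum g ≡ ∑< g (oddDivisorTerm g)
oddDivisorSum≡∑< g = trans (∑-upTo g _) (∑<-cong g (λ y _ → summandOf-oddDivisorSum g y))

module _ {g′ : ℕ} where
  private
    g n : ℕ
    g = suc g′
    n = g + g
    U : List (Vec Bool n)
    U = allStrings n

  weight : ℕ → Vec Bool n → ℤ
  weight y b = when (oddDivisor? g y) (μ (suc y) *ℤ 𝟙 (fixedBy? (g / suc y) b))

  oddDivisorTerm≡∑-weight : ∀ y → oddDivisorTerm g y ≡ ∑ U (weight y)
  oddDivisorTerm≡∑-weight y = by-cases (oddDivisor? g y)
    where
    open ≡-Reasoning
    by-cases : (odd∣g : Dec (suc y ∣ g × suc y % 2 ≡ 1)) →
               when odd∣g (μ (suc y) *ℤ + (2 ^ (g / suc y))) ≡ ∑ U (λ b → when odd∣g (μ (suc y) *ℤ 𝟙 (fixedBy? (g / suc y) b)))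
    by-cases (no _)              = sym (∑-zero U)
    by-cases (yes (x∣g , x-odd)) = begin
      μ (suc y) *ℤ + (2 ^ (g / suc y))                    ≡⟨ cong (μ (suc y) *ℤ_) (sym (∑-𝟙-fixedBy {d = g / suc y} (m/n*n≡m x∣g) x-odd)) ⟩
      μ (suc y) *ℤ ∑ U (𝟙 ∘ fixedBy? (g / suc y))         ≡⟨ sym (∑-*ˡ U (μ (suc y)) (𝟙 ∘ fixedBy? (g / suc y))) ⟩
      ∑ U (λ b → μ (suc y) *ℤ 𝟙 (fixedBy? (g / suc y) b)) ∎

  weight-period : ∀ {b e c} → InB g b → HasPeriod n b (e + e) → g ≡ e * c → c % 2 ≡ 1 →
                  ∀ y → weight y b ≡ when (suc y ∣? c) (μ (suc y))
  weight-period {b} {e} {c} inB hp g≡ec c-odd y = by-cases (oddDivisor? g y)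
    where
    by-cases : (odd∣g : Dec (suc y ∣ g × suc y % 2 ≡ 1)) →
               when odd∣g (μ (suc y) *ℤ 𝟙 (fixedBy? (g / suc y) b)) ≡ when (suc y ∣? c) (μ (suc y))
    by-cases (yes (x∣g , _)) =
      let to , from = periodic-cofactor⇔∣ {e = e} hp g≡ec {suc y} x∣g in
      trans (cong (μ (suc y) *ℤ_) (𝟙-cong (to ∘ proj₂) (λ x∣c → inB , from x∣c) (fixedBy? (g / suc y) b) (suc y ∣? c)))
            (*-𝟙 (μ (suc y)) (suc y ∣? c))
    by-cases (no ¬odd∣g) =
      sym (when-no (λ x∣c → ¬odd∣g (∣-trans x∣c (divides e g≡ec) , ∣-odd x∣c c-odd)) (suc y ∣? c) (μ (suc y)))

  ∑-weight-∉B : ∀ {b} → ¬ InB g b → ∑< g (λ y → weight y b) ≡ 𝟙 (InB'? b)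
  ∑-weight-∉B {b} ∉B = begin
    ∑< g (λ y → weight y b)  ≡⟨ ∑<-zero g (λ y _ → trans (cong (when (oddDivisor? g y)) (weight-0 y)) (when-0 (oddDivisor? g y))) ⟩
    0ℤ                       ≡⟨ sym (𝟙-no (∉B ∘ proj₁) (InB'? b)) ⟩
    𝟙 (InB'? b)              ∎
    where
    open ≡-Reasoning
    weight-0 : ∀ y → μ (suc y) *ℤ 𝟙 (fixedBy? (g / suc y) b) ≡ 0ℤ
    weight-0 y = trans (cong (μ (suc y) *ℤ_) (𝟙-no (∉B ∘ proj₁) (fixedBy? (g / suc y) b))) (ℤₚ.*-zeroʳ (μ (suc y)))

  ∑-weight-period : ∀ {b e c} → InB g b → HasPeriod n b (e + e) → g ≡ e * c → c % 2 ≡ 1 →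
                    ∑< g (λ y → weight y b) ≡ 𝟙 (InB'? b)
  ∑-weight-period {b} {e} {c} inB hp g≡ec c-odd = begin
    ∑< g (λ y → weight y b)                      ≡⟨ ∑<-cong g (λ y _ → weight-period {b} {e} {c} inB hp g≡ec c-odd y) ⟩
    ∑< g (λ y → when (suc y ∣? c) (μ (suc y)))   ≡⟨ sym (∑∣≡∑<-suc g μ 1≤c c≤g) ⟩
    ∑∣ c μ                                       ≡⟨ ∑∣-μ 1≤c ⟩
    𝟙 (c ℕ.≟ 1)                                  ≡⟨ 𝟙-cong c≡1⇒full full⇒c≡1 (c ℕ.≟ 1) (InB'? b) ⟩
    𝟙 (InB'? b)                                  ∎
    where
    open ≡-Reasoning
    instance
      e≢0 : NonZero e
      e≢0 = ℕ.≢-nonZero λ { refl → ℕₚ.0≢1+n (sym g≡ec) }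
    1≤c : 1 ≤ c
    1≤c = ℕₚ.n≢0⇒n>0 λ { refl → ℕₚ.0≢1+n (trans (sym (ℕₚ.*-zeroʳ e)) (sym g≡ec)) }
    c≤g : c ≤ g
    c≤g = subst (c ≤_) (sym g≡ec) (ℕₚ.m≤n*m c e)
    c≡1⇒full : c ≡ 1 → InB' g b
    c≡1⇒full refl = inB , subst (λ k → HasPeriod n b (k + k)) (trans (sym (ℕₚ.*-identityʳ e)) (sym g≡ec)) hp
    full⇒c≡1 : InB' g b → c ≡ 1
    full⇒c≡1 (_ , full) = ℕₚ.*-cancelˡ-≡ c 1 e (begin
      e * c  ≡⟨ sym g≡ec ⟩
      g      ≡⟨ sym (+-double-injective (hasPeriod-unique hp full)) ⟩
      e      ≡⟨ sym (ℕₚ.*-identityʳ e) ⟩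
      e * 1  ∎)

  ∑-weight-∈B : ∀ {b} → InB g b → ∑< g (λ y → weight y b) ≡ 𝟙 (InB'? b)
  ∑-weight-∈B {b} inB =
    let p , hp = period b
        e , c , p≡e+e , g≡ec , c-odd = period-InB {g′} {b} inB hp
    in ∑-weight-period {b} {e} {c} inB (subst (HasPeriod n b) p≡e+e hp) g≡ec c-odd

  ∑-weight : ∀ b → ∑< g (λ y → weight y b) ≡ 𝟙 (InB'? b)
  ∑-weight b = case InB? g b of λ { (yes ∈B) → ∑-weight-∈B ∈B ; (no ∉B) → ∑-weight-∉B ∉B }

  oddDivisorSum≡P : oddDivisorSum g ≡ + P g n
  oddDivisorSum≡P = begin
    oddDivisorSum g                                ≡⟨ oddDivisorSum≡∑< g ⟩
    ∑< g (oddDivisorTerm g)                        ≡⟨ ∑<-cong g (λ y _ → oddDivisorTerm≡∑-weight y) ⟩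
    ∑< g (λ y → ∑ U (weight y))                    ≡⟨ sym (∑-upTo g (λ y → ∑ U (weight y))) ⟩
    ∑ (upTo g) (λ y → ∑ U (weight y))              ≡⟨ ∑-comm (upTo g) U weight ⟩
    ∑ U (λ b → ∑ (upTo g) (λ y → weight y b))      ≡⟨ ∑-cong U (λ b → trans (∑-upTo g (λ y → weight y b)) (∑-weight b)) ⟩
    ∑ U (𝟙 ∘ InB'?)                                ≡⟨ sym (length-filter-∑ InB'? U) ⟩
    + P g n                                        ∎
    where open ≡-Reasoning

corollary2p2 : (g : ℕ) → 1 ≤ g →
    Σ (List (Vec Bool (g + g))) (IsTransversalE' g)
    × ((reps : List (Vec Bool (g + g))) → IsTransversalE' g reps →
        (length reps * (g + g) ≡ P g (g + g))
        × (+ (length reps * (g + g)) ≡ oddDivisorSum g))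
corollary2p2 (suc g′) _ = transversal , λ reps isTransversal →
  let size = transversal-size reps isTransversal
  in size , trans (cong +_ size) (sym (oddDivisorSum≡P {g′}))
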